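{- Let $g \ge 1$ be an integer and let $G$ be a finite abelian group with $|G|>1$. Then $$\limsup_{n \to \infty} \frac{\eta_g(G^n)}{\sqrt{g}\,|G|^{n/2}} = 1 + O\!\left(\frac{1}{\sqrt{g}}\right),$$ where the $O$-term refers to $g \to \infty$ with $G$ fixed. In particular, $$\lim_{g \to \infty} \limsup_{n \to \infty} \frac{\eta_g(G^n)}{\sqrt{g}\,|G|^{n/2}} = \lim_{g \to \infty} \liminf_{n \to \infty} \frac{\eta_g(G^n)}{\sqrt{g}\,|G|^{n/2}} = 1.$$ The same statements hold with $\eta_g$ replaced by $\nu_g$.
   Context: For a finite abelian group $G$ (written additively) and subsets $A,B \subseteq G$, let $r_{A+B}(x)=|\{(a,b)\in A\times B : a+b=x\}|$ and $r_{A-B}(x)=|\{(a,b)\in A\times B : a-b=x\}|$. For a positive integer $g$, a subset $A\subseteq G$ is a $g$-additive basis for $G$ if $r_{A+A}(x)\ge g$ for all $x\in G$, and a $g$-difference basis for $G$ if $r_{A-A}(x)\ge g$ for all $x \in G$. $\nu_g(G)$ denotes the minimum size of a $g$-additive basis for $G$ and $\eta_g(G)$ the minimum size of a $g$-difference basis for $G$ (these exist once $|G|$ is large enough relative to $g$). $G^n$ denotes the direct product of $n$ copies of $G$. -}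

module Defs where

open import Data.Nat using (ℕ; _≤_; _<_; _^_)
open import Data.Fin using (Fin)
open import Data.Fin.Properties using () renaming (_≟_ to _≟ᶠ_)
open import Data.Vec using (Vec; zipWith; map)
open import Data.Vec.Properties using (≡-dec)
open import Data.List using (List; length; filter; cartesianProduct)
open import Data.List.Relation.Unary.Unique.Propositional using (Unique)
open import Data.Product using (Σ; _×_; _,_; proj₁; proj₂)
open import Data.Integer using (+_)
open import Data.Rational using (ℚ; _/_; 0ℚ; 1ℚ; Positive) renaming (_≤_ to _≤ℚ_; _+_ to _+ℚ_; _*_ to _*ℚ_; _-_ to _-ℚ_)
open import Data.Sum using (_⊎_)
open import Data.Nat using (_*_)
open import Relation.Binary.PropositionalEquality using (_≡_)
open import Relation.Nullary using (Dec)

ℕtoℚ : ℕ → ℚ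
ℕtoℚ k = (+ k) / 1

-- Asymptotic conditions, stated without reals.
-- For a sequence e : ℕ → ℕ put b n = e(n)² / (g · m^n), i.e. b n = a n ² where
-- a n = e(n) / (√g · m^(n/2)).  With  M n = g·m^n  and  E n = e(n)²:
--
-- LimsupUpper D g m e  ⇔  limsup_n b n ≤ 1 + √(D/g)
--   (∀ ε>0, eventually  b n - 1 - ε ≤ √(D/g), i.e. with x = E - (1+ε)M:
--    x ≤ 0 or g x² ≤ D M²)
LimsupUpper : ℚ → ℕ → ℕ → (ℕ → ℕ) → Set
LimsupUpper D g m e =
  ∀ (ε : ℚ) → Positive ε → Σ ℕ λ N → ∀ n → N ≤ n →
    let Mn = ℕtoℚ (g * m ^ n)
        x  = ℕtoℚ (e n * e n) -ℚ ((1ℚ +ℚ ε) *ℚ Mn)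
    in (x ≤ℚ 0ℚ) ⊎ (ℕtoℚ g *ℚ (x *ℚ x) ≤ℚ D *ℚ (Mn *ℚ Mn))

-- LimsupLower D g m e  ⇔  limsup_n b n ≥ 1 - √(D/g)
--   (∀ ε>0, infinitely often  1 - ε - b n ≤ √(D/g), i.e. with y = (1-ε)M - E:
--    y ≤ 0 or g y² ≤ D M²)
LimsupLower : ℚ → ℕ → ℕ → (ℕ → ℕ) → Set
LimsupLower D g m e =
  ∀ (ε : ℚ) → Positive ε → ∀ (N : ℕ) → Σ ℕ λ n → N ≤ n ×
    (let Mn = ℕtoℚ (g * m ^ n)
         y  = ((1ℚ -ℚ ε) *ℚ Mn) -ℚ ℕtoℚ (e n * e n)
     in (y ≤ℚ 0ℚ) ⊎ (ℕtoℚ g *ℚ (y *ℚ y) ≤ℚ D *ℚ (Mn *ℚ Mn)))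

-- A finite abelian group of order m is represented (up to isomorphism) by
-- an abelian group structure on Fin m with propositional equality.
module FinGroup (m : ℕ) (_∙_ : Fin m → Fin m → Fin m) (_⁻¹ : Fin m → Fin m) where

  El : ℕ → Set
  El n = Vec (Fin m) n

  _≟_ : ∀ {n} (x y : El n) → Dec (x ≡ y)
  _≟_ = ≡-dec _≟ᶠ_

  _⊕_ : ∀ {n} → El n → El n → El n
  _⊕_ = zipWith _∙_

  _⊖_ : ∀ {n} → El n → El n → El n
  a ⊖ b = zipWith _∙_ a (map _⁻¹ b)

  rSum : ∀ {n} → List (El n) → El n → ℕ
  rSum A x = length (filter (λ p → (proj₁ p ⊕ proj₂ p) ≟ x) (cartesianProduct A A))

  rDiff : ∀ {n} → List (El n) → El n → ℕ
  rDiff A x = length (filter (λ p → (proj₁ p ⊖ proj₂ p) ≟ x) (cartesianProduct A A))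

  -- Subsets of G^n are duplicate-free lists; |A| = length A.
  IsAddBasis : ℕ → ∀ n → List (El n) → Set
  IsAddBasis g n A = ∀ (x : El n) → g ≤ rSum A x

  IsDiffBasis : ℕ → ∀ n → List (El n) → Set
  IsDiffBasis g n A = ∀ (x : El n) → g ≤ rDiff A x

  IsNu : ℕ → ℕ → ℕ → Set
  IsNu g n k =
    Σ (List (El n)) (λ A → Unique A × length A ≡ k × IsAddBasis g n A)
    × (∀ (A : List (El n)) → Unique A → IsAddBasis g n A → k ≤ length A)

  IsEta : ℕ → ℕ → ℕ → Set
  IsEta g n k =
    Σ (List (El n)) (λ A → Unique A × length A ≡ k × IsDiffBasis g n A)
    × (∀ (A : List (El n)) → Unique A → IsDiffBasis g n A → k ≤ length A)

-- Lower bound: the pairs of A × A are distributed over the |G|ⁿ possible sums (differences), so a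
-- g-basis has |A|² ≥ g |G|ⁿ for every n.
--
-- Upper bound: write n = w + d with w < 4 and let W = |G|ʷ, W t² < g ≤ W (t + 1)². If G^d contains
-- t + 3 subgroups of order h = |G|^(d/2) meeting pairwise in 0, then A = Gʷ × (their union) is a
-- g-difference and g-additive basis: (x, 0) is represented h times inside one subgroup, and
-- (x, u) with u ≠ 0 avoids all but one subgroup, while any two subgroups X, Y satisfy X - Y = G^d
-- and so give W representations per ordered pair. As |A| ≤ W (1 + (t + 3) h), this yields
-- |A|² ≤ (1 + O(1/√g)) g |G|ⁿ.
--
-- Such subgroups exist in G^(2k) when k + 1 = P ± 1 for a multiple P of every element order and
-- of every number ≤ g: take {0} × Gᵏ and the graphs of the powers of the cyclic shift on the
-- sum-zero subgroup of G^(k+1) ≅ Gᵏ. Products of these for k = P and k = P - 2 reach every large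
-- multiple of 4.

{-# OPTIONS --safe #-}
module Submission where

open import Defs
open import Algebra.Bundles using (AbelianGroup)
open import Algebra.Core using (Op₁; Op₂)
open import Algebra.Structures using (IsAbelianGroup)
import Algebra.Properties.AbelianGroup as AbelianGroupProperties
import Algebra.Properties.CommutativeSemigroup as CommutativeSemigroupProperties
open import Data.Bool using (if_then_else_)
open import Data.Empty using (⊥-elim)
open import Data.Fin using (Fin; toℕ) renaming (zero to fzero; suc to fsuc)
open import Data.Fin.Properties using (pigeonhole; toℕ≤pred[n]; toℕ-injective; toℕ<n) renaming (_≟_ to _≟ᶠ_)
import Data.Integer as ℤ
import Data.Integer.Properties as ℤ
open import Data.List using (List; []; _∷_; [_]; length; map; filter; concatMap; allFin; cartesianProduct; cartesianProductWith)
  renaming (_++_ to _++ᴸ_)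
open import Data.List.Properties
  using (map-cong; length-map; length-++; length-filter; length-tabulate; filter-all; filter-notAll; ++-identityʳ; ++-assoc)
open import Data.List.Membership.Propositional using (_∈_; _∉_; find; lose)
open import Data.List.Membership.Propositional.Properties
  using (∈-filter⁺; ∈-filter⁻; ∈-map⁺; ∈-map⁻; ∈-concatMap⁺; ∈-concatMap⁻; ∈-allFin;
         ∈-cartesianProduct⁺; ∈-cartesianProduct⁻; ∈-cartesianProductWith⁺; ∈-cartesianProductWith⁻)
open import Data.List.Relation.Binary.Disjoint.Propositional using (Disjoint)
open import Data.List.Relation.Binary.Subset.Propositional using (_⊆_)
open import Data.List.Relation.Unary.Any as Any using (here; there)
import Data.List.Relation.Unary.All as All
import Data.List.Relation.Unary.All.Properties as All
open import Data.List.Relation.Unary.AllPairs as AllPairs using ([]; _∷_)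
import Data.List.Relation.Unary.AllPairs.Properties as AllPairs
open import Data.List.Relation.Unary.Unique.Propositional using (Unique)
open import Data.List.Relation.Unary.Unique.Propositional.Properties
  using (Unique[x∷xs]⇒x∉xs; concat⁺; map⁺; filter⁺; allFin⁺; cartesianProduct⁺; cartesianProductWith⁺)
open import Data.Nat using (ℕ; zero; suc; _+_; _*_; _∸_; _^_; _≤_; _<_; _≤?_; z≤n; s≤s; _!; NonZero; >-nonZero; _/_; _%_)
open import Data.Nat.Properties hiding (_≟_)
import Data.Nat.Coprimality as Coprimality
open import Data.Nat.DivMod using (m≡m%n+[m/n]*n; m%n<n; /-monoˡ-≤; m*n/n≡m)
open import Data.Nat.Divisibility using (_∣_; divides; ∣-trans; ∣-refl; m∣m*n; n∣m*n; ∣m∣n⇒∣m+n)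
open import Data.Nat.ListAction using (sum)
open import Data.Nat.Solver using (module +-*-Solver)
open import Data.Product using (Σ; ∃; ∃₂; _×_; _,_; proj₁; proj₂)
import Data.Product.Properties as Product
open import Data.Rational as ℚ using (ℚ; 0ℚ; 1ℚ; mkℚ)
  renaming (_≤_ to _≤ℚ_; _+_ to _+ℚ_; _*_ to _*ℚ_; _-_ to _-ℚ_)
import Data.Rational.Properties as ℚ
import Data.Rational.Solver
open import Data.Sum using (_⊎_; inj₁; inj₂; [_,_]′)
open import Data.Vec using (Vec; []; _∷_; _∷ʳ_; zipWith; replicate; toList; tail; _++_; splitAt) renaming (map to mapᵛ)
open import Data.Vec.Properties
  using (zipWith-assoc; zipWith-comm; zipWith-identityˡ; zipWith-identityʳ; zipWith-inverseˡ; zipWith-inverseʳ;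
         zipWith-++; map-++; map-∷ʳ; ∷-injective; ∷ʳ-injective; ++-injective; ++-injectiveˡ; ++-injectiveʳ;
         toList-∷ʳ; toList-injective; length-toList; cast-is-id)
open import Function using (id; _∘′_)
open import Relation.Nullary using (¬_; Dec; yes; no; does; ¬?)
open import Relation.Nullary.Decidable using (decidable-stable; toSum)
open import Relation.Nullary.Negation using (contradiction)
open import Relation.Unary using (Pred; Decidable)
open import Relation.Binary.Definitions using (DecidableEquality; tri<; tri≈; tri>)
open import Relation.Binary.PropositionalEquality
  using (_≡_; _≢_; refl; sym; trans; cong; cong₂; subst; subst₂; isEquivalence; module ≡-Reasoning)

open CommutativeSemigroupProperties +-commutativeSemigroup using () renaming (interchange to +-interchange)
module ℚ-Solver = Data.Rational.Solver.+-*-Solver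

length-cartesianProductWith : ∀ {A B C : Set} (f : A → B → C) xs ys →
  length (cartesianProductWith f xs ys) ≡ length xs * length ys
length-cartesianProductWith f []       ys = refl
length-cartesianProductWith f (x ∷ xs) ys = trans (length-++ (map (f x) ys))
  (cong₂ _+_ (length-map (f x) ys) (length-cartesianProductWith f xs ys))

length-concatMap-≤ : ∀ {I B : Set} (f : I → List B) {k} is →
  (∀ i → length (f i) ≤ k) → length (concatMap f is) ≤ length is * k
length-concatMap-≤ f []       _ = z≤n
length-concatMap-≤ f (i ∷ is) h =
  ≤-trans (≤-reflexive (length-++ (f i))) (+-mono-≤ (h i) (length-concatMap-≤ f is h))

length-concatMap-≥ : ∀ {I B : Set} (f : I → List B) {k} is →
  (∀ {i} → i ∈ is → k ≤ length (f i)) → length is * k ≤ length (concatMap f is)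
length-concatMap-≥ f []       _ = z≤n
length-concatMap-≥ f (i ∷ is) h = ≤-trans
  (+-mono-≤ (h (here refl)) (length-concatMap-≥ f is (h ∘′ there)))
  (≤-reflexive (sym (length-++ (f i))))

sum-map-+ : ∀ {A : Set} (f g : A → ℕ) xs → sum (map (λ x → f x + g x) xs) ≡ sum (map f xs) + sum (map g xs)
sum-map-+ f g []       = refl
sum-map-+ f g (x ∷ xs) = trans (cong (f x + g x +_) (sum-map-+ f g xs))
  (+-interchange (f x) (g x) (sum (map f xs)) (sum (map g xs)))

sum-map-≥ : ∀ {A : Set} (f : A → ℕ) {k} xs → (∀ x → k ≤ f x) → k * length xs ≤ sum (map f xs)
sum-map-≥ f {k} []       _ = ≤-reflexive (*-zeroʳ k)
sum-map-≥ f {k} (x ∷ xs) h = ≤-trans (≤-reflexive (*-suc k (length xs))) (+-mono-≤ (h x) (sum-map-≥ f xs h))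

unique-map-injectiveOn : ∀ {A B : Set} {f : A → B} {xs} → Unique xs →
  (∀ {x y} → x ∈ xs → y ∈ xs → f x ≡ f y → x ≡ y) → Unique (map f xs)
unique-map-injectiveOn {xs = []}     _            _   = []
unique-map-injectiveOn {xs = x ∷ xs} (x∉xs ∷ u) inj =
  All.map⁺ (All.tabulate λ y∈xs fx≡fy → All.lookup x∉xs y∈xs (inj (here refl) (there y∈xs) fx≡fy))
  ∷ unique-map-injectiveOn u (λ x∈ y∈ → inj (there x∈) (there y∈))

module _ {A : Set} (_≟_ : DecidableEquality A) where

  open import Data.List.Membership.DecPropositional _≟_ using (_∈?_)

  private
    others : A → List A → List A
    others x = filter (λ y → ¬? (x ≟ y))

    length-others< : ∀ {x ys} → x ∈ ys → length (others x ys) < length ys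
    length-others< {x} {ys} x∈ys = filter-notAll (λ y → ¬? (x ≟ y)) ys (Any.map (λ x≡y x≢y → x≢y x≡y) x∈ys)

    ⊆-others : ∀ {x xs ys} → x ∉ xs → xs ⊆ ys → xs ⊆ others x ys
    ⊆-others {x} x∉xs xs⊆ys y∈xs = ∈-filter⁺ (λ y → ¬? (x ≟ y)) (xs⊆ys y∈xs) (λ { refl → x∉xs y∈xs })

  length-mono-⊆ : ∀ {xs ys} → Unique xs → xs ⊆ ys → length xs ≤ length ys
  length-mono-⊆ {[]}     _         _     = z≤n
  length-mono-⊆ {x ∷ xs} u@(_ ∷ u′) xs⊆ys = ≤-trans
    (s≤s (length-mono-⊆ u′ (⊆-others (Unique[x∷xs]⇒x∉xs u) (xs⊆ys ∘′ there))))
    (length-others< (xs⊆ys (here refl)))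

  ⊆∧length≥⇒⊇ : ∀ {xs ys} → Unique xs → xs ⊆ ys → length ys ≤ length xs → ys ⊆ xs
  ⊆∧length≥⇒⊇ {xs} u xs⊆ys ys≤xs {y} y∈ys with y ∈? xs
  ... | yes y∈xs = y∈xs
  ... | no  y∉xs = ⊥-elim (<-irrefl refl
    (≤-<-trans (length-mono-⊆ u (⊆-others y∉xs xs⊆ys)) (<-≤-trans (length-others< y∈ys) ys≤xs)))

  length≤suc-filter : ∀ {p} {P : Pred A p} (P? : Decidable P) {xs} → Unique xs →
    (∀ {a b} → a ∈ xs → b ∈ xs → ¬ P a → ¬ P b → a ≡ b) → length xs ≤ suc (length (filter P? xs))
  length≤suc-filter P? {[]}     _          _ = z≤n
  length≤suc-filter {P = P} P? {x ∷ xs} u@(_ ∷ u′) atMostOne with P? x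
  ... | yes _  = s≤s (length≤suc-filter P? u′ (λ a∈ b∈ → atMostOne (there a∈) (there b∈)))
  ... | no ¬Px = s≤s (≤-reflexive (cong length (sym (filter-all P? (All.tabulate P-rest)))))
    where
    P-rest : ∀ {y} → y ∈ xs → P y
    P-rest {y} y∈xs = decidable-stable (P? y) λ ¬Py →
      Unique[x∷xs]⇒x∉xs u (subst (_∈ xs) (atMostOne (there y∈xs) (here refl) ¬Py ¬Px) y∈xs)

  private
    δ : A → A → ℕ
    δ y x = if does (y ≟ x) then 1 else 0

    sum-δ-∉ : ∀ y xs → y ∉ xs → sum (map (δ y) xs) ≡ 0
    sum-δ-∉ y []       _    = refl
    sum-δ-∉ y (x ∷ xs) y∉ with y ≟ x
    ... | yes y≡x = ⊥-elim (y∉ (here y≡x))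
    ... | no  _   = sum-δ-∉ y xs (y∉ ∘′ there)

    sum-δ-∈ : ∀ y {xs} → Unique xs → y ∈ xs → sum (map (δ y) xs) ≡ 1
    sum-δ-∈ y {x ∷ xs} u@(_ ∷ u′) y∈ with y ≟ x | y∈
    ... | yes refl | _         = cong suc (sum-δ-∉ y xs (Unique[x∷xs]⇒x∉xs u))
    ... | no y≢x   | here y≡x  = ⊥-elim (y≢x y≡x)
    ... | no _     | there y∈′ = sum-δ-∈ y u′ y∈′

    length-filter-∷ : ∀ {B : Set} (f : B → A) p ps x →
      length (filter (λ q → f q ≟ x) (p ∷ ps)) ≡ δ (f p) x + length (filter (λ q → f q ≟ x) ps)
    length-filter-∷ f p ps x with f p ≟ x
    ... | yes _ = refl
    ... | no  _ = refl

  sum-length-fibres : ∀ {B : Set} (f : B → A) (ps : List B) {xs} → Unique xs → (∀ x → x ∈ xs) →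
    sum (map (λ x → length (filter (λ p → f p ≟ x) ps)) xs) ≡ length ps
  sum-length-fibres f []       {xs} _ _ = sum-map-0 xs
    where
    sum-map-0 : ∀ (xs : List A) → sum (map (λ _ → 0) xs) ≡ 0
    sum-map-0 []       = refl
    sum-map-0 (_ ∷ xs) = sum-map-0 xs
  sum-length-fibres f (p ∷ ps) {xs} u complete = begin
    sum (map (λ x → length (filter (λ q → f q ≟ x) (p ∷ ps))) xs)
      ≡⟨ cong sum (map-cong (length-filter-∷ f p ps) xs) ⟩
    sum (map (λ x → δ (f p) x + length (filter (λ q → f q ≟ x) ps)) xs)
      ≡⟨ sum-map-+ (δ (f p)) (λ x → length (filter (λ q → f q ≟ x) ps)) xs ⟩
    sum (map (δ (f p)) xs) + sum (map (λ x → length (filter (λ q → f q ≟ x) ps)) xs)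
      ≡⟨ cong₂ _+_ (sum-δ-∈ (f p) u (complete (f p))) (sum-length-fibres f ps u complete) ⟩
    suc (length ps) ∎
    where open ≡-Reasoning

unique-concatMap : ∀ {I B : Set} (f : I → List B) {is} → Unique is → (∀ i → Unique (f i)) →
  (∀ {i j} → i ≢ j → Disjoint (f i) (f j)) → Unique (concatMap f is)
unique-concatMap f {is} u f-unique f-disjoint =
  concat⁺ (All.map⁺ (All.universal f-unique is)) (AllPairs.map⁺ (AllPairs.map f-disjoint u))

module _ {I : Set} (_≟_ : DecidableEquality I) where

  private
    row : List I → I → List (I × I)
    row is i = map (i ,_) (filter (λ j → ¬? (i ≟ j)) is)

    ∈-row⁻ : ∀ {is i p} → p ∈ row is i → proj₁ p ≡ i × proj₂ p ∈ is × i ≢ proj₂ p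
    ∈-row⁻ {is} {i} p∈ with j , j∈ , refl ← ∈-map⁻ (i ,_) p∈ =
      let j∈is , i≢j = ∈-filter⁻ (λ j → ¬? (i ≟ j)) j∈ in refl , j∈is , i≢j

  offDiagonal : List I → List (I × I)
  offDiagonal is = concatMap (row is) is

  ∈-offDiagonal⁻ : ∀ {is p} → p ∈ offDiagonal is → proj₁ p ∈ is × proj₂ p ∈ is × proj₁ p ≢ proj₂ p
  ∈-offDiagonal⁻ {is} p∈ with find (∈-concatMap⁻ (row is) {xs = is} p∈)
  ... | i , i∈ , p∈row with refl , j∈ , i≢j ← ∈-row⁻ {is} p∈row = i∈ , j∈ , i≢j

  offDiagonal-unique : ∀ {is} → Unique is → Unique (offDiagonal is)
  offDiagonal-unique {is} u = unique-concatMap (row is) u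
    (λ i → map⁺ (cong proj₂) (filter⁺ (λ j → ¬? (i ≟ j)) u))
    (λ i≢i′ (p∈ , p∈′) → i≢i′ (trans (sym (proj₁ (∈-row⁻ {is} p∈))) (proj₁ (∈-row⁻ {is} p∈′))))

  length-offDiagonal : ∀ {is} → Unique is → length is * (length is ∸ 1) ≤ length (offDiagonal is)
  length-offDiagonal {is} u = length-concatMap-≥ (row is) is λ {i} _ → begin
    length is ∸ 1                                   ≤⟨ ∸-monoˡ-≤ 1 (length≤suc-filter _≟_ (λ j → ¬? (i ≟ j)) u
                                                         (λ _ _ i≡a i≡b → trans (sym (stable i≡a)) (stable i≡b))) ⟩
    length (filter (λ j → ¬? (i ≟ j)) is)          ≡⟨ length-map (i ,_) (filter (λ j → ¬? (i ≟ j)) is) ⟨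
    length (row is i)                               ∎
    where
    open ≤-Reasoning
    stable : ∀ {i j} → ¬ ¬ i ≡ j → i ≡ j
    stable {i} {j} = decidable-stable (i ≟ j)

module _ {A : Set} where

  rotate : ∀ {k} → Vec A (suc k) → Vec A (suc k)
  rotate (x ∷ xs) = xs ∷ʳ x

  rotate^ : ∀ {k} → ℕ → Vec A (suc k) → Vec A (suc k)
  rotate^ zero    y = y
  rotate^ (suc c) y = rotate^ c (rotate y)

  rotate^-+ : ∀ {k} a b (y : Vec A (suc k)) → rotate^ (a + b) y ≡ rotate^ b (rotate^ a y)
  rotate^-+ zero    b y = refl
  rotate^-+ (suc a) b y = rotate^-+ a b (rotate y)

  rotate^-* : ∀ {k} d t {y : Vec A (suc k)} → rotate^ d y ≡ y → rotate^ (t * d) y ≡ y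
  rotate^-* d zero    _      = refl
  rotate^-* d (suc t) {y} fixed = trans (rotate^-+ d (t * d) y) (trans (cong (rotate^ (t * d)) fixed) (rotate^-* d t fixed))

  rotate^-∣ : ∀ {k d n} {y : Vec A (suc k)} → rotate^ d y ≡ y → d ∣ n → rotate^ n y ≡ y
  rotate^-∣ {d = d} fixed (divides t refl) = rotate^-* d t fixed

  rotate-injective : ∀ {k} {y z : Vec A (suc k)} → rotate y ≡ rotate z → y ≡ z
  rotate-injective {y = x ∷ xs} {z = x′ ∷ xs′} eq with ∷ʳ-injective xs xs′ eq
  ... | refl , refl = refl

  rotate^-injective : ∀ {k} c {y z : Vec A (suc k)} → rotate^ c y ≡ rotate^ c z → y ≡ z
  rotate^-injective zero    eq = eq
  rotate^-injective (suc c) eq = rotate-injective (rotate^-injective c eq)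

  private
    rotateᴸ : List A → List A
    rotateᴸ []        = []
    rotateᴸ (x ∷ xs) = xs ++ᴸ (x ∷ [])

    rotateᴸ^ : ℕ → List A → List A
    rotateᴸ^ zero    xs = xs
    rotateᴸ^ (suc c) xs = rotateᴸ^ c (rotateᴸ xs)

    rotateᴸ^-++ : ∀ xs ys → rotateᴸ^ (length xs) (xs ++ᴸ ys) ≡ ys ++ᴸ xs
    rotateᴸ^-++ []        ys = sym (++-identityʳ ys)
    rotateᴸ^-++ (x ∷ xs) ys = trans (cong (rotateᴸ^ (length xs)) (++-assoc xs ys (x ∷ [])))
      (trans (rotateᴸ^-++ xs (ys ++ᴸ (x ∷ []))) (++-assoc ys (x ∷ []) xs))

    toList-rotate^ : ∀ {k} c (y : Vec A (suc k)) → toList (rotate^ c y) ≡ rotateᴸ^ c (toList y)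
    toList-rotate^ zero    y        = refl
    toList-rotate^ (suc c) (x ∷ xs) = trans (toList-rotate^ c (xs ∷ʳ x)) (cong (rotateᴸ^ c) (toList-∷ʳ x xs))

  rotate^-period : ∀ {k} (y : Vec A (suc k)) → rotate^ (suc k) y ≡ y
  rotate^-period {k} y = trans (sym (cast-is-id refl _)) (toList-injective refl (rotate^ (suc k) y) y (begin
    toList (rotate^ (suc k) y)                     ≡⟨ toList-rotate^ (suc k) y ⟩
    rotateᴸ^ (suc k) (toList y)                    ≡⟨ cong (λ c → rotateᴸ^ c (toList y)) (length-toList {A = A} y) ⟨
    rotateᴸ^ (length (toList y)) (toList y)        ≡⟨ cong (rotateᴸ^ (length (toList y))) (++-identityʳ (toList y)) ⟨
    rotateᴸ^ (length (toList y)) (toList y ++ᴸ []) ≡⟨ rotateᴸ^-++ (toList y) [] ⟩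
    toList y                                       ∎))
    where open ≡-Reasoning

  rotate-fixed⇒replicate : ∀ {k} {y : Vec A (suc k)} → rotate y ≡ y → ∃ λ c → y ≡ replicate (suc k) c
  rotate-fixed⇒replicate {y = x ∷ xs} fixed = x , cong (x ∷_) (∷ʳ-fixed xs fixed)
    where
    ∷ʳ-fixed : ∀ {k} (xs : Vec A k) → xs ∷ʳ x ≡ x ∷ xs → xs ≡ replicate k x
    ∷ʳ-fixed []        _   = refl
    ∷ʳ-fixed (y ∷ xs) eq with ∷-injective eq
    ... | refl , eq′ = cong (y ∷_) (∷ʳ-fixed xs eq′)

rotate^-zipWith : ∀ {A B C : Set} (f : A → B → C) {k} c (y : Vec A (suc k)) z →
  rotate^ c (zipWith f y z) ≡ zipWith f (rotate^ c y) (rotate^ c z)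
rotate^-zipWith f zero    y        z        = refl
rotate^-zipWith f (suc c) (x ∷ xs) (x′ ∷ xs′) =
  trans (cong (rotate^ c) (sym (zipWith-∷ʳ xs xs′))) (rotate^-zipWith f c (xs ∷ʳ x) (xs′ ∷ʳ x′))
  where
  zipWith-∷ʳ : ∀ {k} (xs : Vec _ k) xs′ → zipWith f (xs ∷ʳ x) (xs′ ∷ʳ x′) ≡ zipWith f xs xs′ ∷ʳ f x x′
  zipWith-∷ʳ []        []          = refl
  zipWith-∷ʳ (y ∷ xs) (y′ ∷ xs′) = cong (f y y′ ∷_) (zipWith-∷ʳ xs xs′)

rotate^-map : ∀ {A B : Set} (f : A → B) {k} c (y : Vec A (suc k)) → rotate^ c (mapᵛ f y) ≡ mapᵛ f (rotate^ c y)
rotate^-map f zero    y        = refl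
rotate^-map f (suc c) (x ∷ xs) = trans (cong (rotate^ c) (sym (map-∷ʳ f x xs))) (rotate^-map f c (xs ∷ʳ x))

∣-! : ∀ {d} n → 1 ≤ d → d ≤ n → d ∣ n !
∣-! zero (s≤s z≤n) ()
∣-! {d} (suc n) 1≤d d≤1+n with m≤n⇒m<n∨m≡n d≤1+n
... | inj₂ refl      = m∣m*n (n !)
... | inj₁ (s≤s d≤n) = ∣-trans (∣-! n 1≤d d≤n) (n∣m*n (suc n))

n<m^n : ∀ {m} → 1 < m → ∀ n → n < m ^ n
n<m^n 1<m zero    = s≤s z≤n
n<m^n {m} 1<m (suc n) = begin-strict
  suc n            ≤⟨ n<m^n 1<m n ⟩
  m ^ n            <⟨ m<m*n (m ^ n) m {{m^n≢0 m n {{>-nonZero (<-trans (s≤s z≤n) 1<m)}}}} 1<m ⟩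
  m ^ n * m        ≡⟨ *-comm (m ^ n) m ⟩
  m ^ suc n        ∎
  where open ≤-Reasoning

sqrt-bracket : ∀ {g W} → 1 ≤ g → 1 ≤ W → ∃ λ t → W * (t * t) < g × g ≤ W * (suc t * suc t)
sqrt-bracket {g} {W} 1≤g 1≤W = search g (≤-trans (m≤m*n g g) (m≤n*m (g * g) W))
  where
  instance
    _ = >-nonZero 1≤g
    _ = >-nonZero 1≤W
  search : ∀ b → g ≤ W * (b * b) → ∃ λ t → W * (t * t) < g × g ≤ W * (suc t * suc t)
  search zero    g≤0 = contradiction (≤-trans 1≤g (≤-trans g≤0 (≤-reflexive (*-zeroʳ W)))) λ ()
  search (suc b) g≤W[1+b]² with g ≤? W * (b * b)
  ... | yes g≤Wb² = search b g≤Wb²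
  ... | no  g≰Wb² = b , ≰⇒> g≰Wb² , g≤W[1+b]²

frobenius : ∀ p .{{_ : NonZero p}} k → p * p ≤ k → ∃₂ λ a b → a * suc p + b * p ≡ k
frobenius p k p²≤k = k % p , (k / p ∸ k % p) , (begin-equality
  k % p * suc p + (k / p ∸ k % p) * p ≡⟨ rearrange (k % p) (k / p ∸ k % p) p ⟩
  k % p + (k % p + (k / p ∸ k % p)) * p ≡⟨ cong (λ q → k % p + q * p) (m+[n∸m]≡n k%p≤k/p) ⟩
  k % p + k / p * p                   ≡⟨ m≡m%n+[m/n]*n k p ⟨
  k                                   ∎)
  where
  open ≤-Reasoning
  open +-*-Solver
  rearrange : ∀ r s p → r * suc p + s * p ≡ r + (r + s) * p
  rearrange = solve 3 (λ r s p → r :* (con 1 :+ p) :+ s :* p := r :+ (r :+ s) :* p) refl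
  p≤k/p : p ≤ k / p
  p≤k/p = ≤-pred (*-cancelʳ-< p p (suc (k / p)) (begin-strict
    p * p               ≤⟨ p²≤k ⟩
    k                   ≡⟨ m≡m%n+[m/n]*n k p ⟩
    k % p + k / p * p   <⟨ +-monoˡ-< (k / p * p) (m%n<n k p) ⟩
    p + k / p * p       ∎))
  k%p≤k/p : k % p ≤ k / p
  k%p≤k/p = ≤-trans (<⇒≤ (m%n<n k p)) p≤k/p

private
  [8t+16]²≤576[t²+1] : ∀ t → (8 * t + 16) * (8 * t + 16) ≤ 576 * (t * t + 1)
  [8t+16]²≤576[t²+1] t = begin
    (8 * t + 16) * (8 * t + 16)           ≡⟨ expand t ⟩
    64 * (t * t) + 256 * t + 256          ≤⟨ +-monoˡ-≤ 256 (+-monoʳ-≤ (64 * (t * t)) (*-monoʳ-≤ 256 (t≤t²+1 t))) ⟩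
    64 * (t * t) + 256 * (t * t + 1) + 256 ≡⟨ collect t ⟩
    320 * (t * t) + 512                   ≤⟨ +-mono-≤ (*-monoˡ-≤ (t * t) (m≤m+n 320 256)) (m≤m+n 512 64) ⟩
    576 * (t * t) + 576                   ≡⟨ *-distribˡ-+ 576 (t * t) 1 ⟨
    576 * (t * t + 1)                     ∎
    where
    open ≤-Reasoning
    open +-*-Solver
    expand : ∀ t → (8 * t + 16) * (8 * t + 16) ≡ 64 * (t * t) + 256 * t + 256
    expand = solve 1 (λ t → (con 8 :* t :+ con 16) :* (con 8 :* t :+ con 16)
                          := con 64 :* (t :* t) :+ con 256 :* t :+ con 256) refl
    collect : ∀ t → 64 * (t * t) + 256 * (t * t + 1) + 256 ≡ 320 * (t * t) + 512
    collect = solve 1 (λ t → con 64 :* (t :* t) :+ con 256 :* (t :* t :+ con 1) :+ con 256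
                           := con 320 :* (t :* t) :+ con 512) refl
    t≤t²+1 : ∀ t → t ≤ t * t + 1
    t≤t²+1 zero    = z≤n
    t≤t²+1 (suc u) = ≤-trans (m≤m*n (suc u) (suc u)) (m≤m+n _ 1)

square-excess : ∀ {g t W h s} → W * (t * t) < g → s ≤ W * suc ((t + 3) * h) → 1 ≤ h →
  let T = W * (h * h) in s * s ∸ g * T ≤ W * (8 * t + 16) * T
square-excess {g} {t} {W} {h} {s} Wt²<g s≤ 1≤h = begin
  s * s ∸ g * T          ≤⟨ ∸-monoˡ-≤ (g * T) s²≤KT ⟩
  K * T ∸ g * T          ≡⟨ *-distribʳ-∸ T K g ⟨
  (K ∸ g) * T            ≤⟨ *-monoˡ-≤ T K∸g≤ ⟩
  W * (8 * t + 16) * T   ∎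
  where
  open ≤-Reasoning
  open +-*-Solver
  T = W * (h * h)
  K = W * ((t + 4) * (t + 4))

  s≤W[t+4]h : s ≤ W * ((t + 4) * h)
  s≤W[t+4]h = ≤-trans s≤ (*-monoʳ-≤ W (≤-trans (+-monoˡ-≤ ((t + 3) * h) 1≤h)
                (≤-reflexive (solve 2 (λ t h → h :+ (t :+ con 3) :* h := (t :+ con 4) :* h) refl t h))))

  s²≤KT : s * s ≤ K * T
  s²≤KT = begin
    s * s                                     ≤⟨ *-mono-≤ s≤W[t+4]h s≤W[t+4]h ⟩
    (W * ((t + 4) * h)) * (W * ((t + 4) * h)) ≡⟨ solve 3 (λ W t h → (W :* ((t :+ con 4) :* h)) :* (W :* ((t :+ con 4) :* h))
                                                  := W :* ((t :+ con 4) :* (t :+ con 4)) :* (W :* (h :* h))) refl W t h ⟩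
    K * T                                     ∎

  K∸g≤ : K ∸ g ≤ W * (8 * t + 16)
  K∸g≤ = begin
    K ∸ g                                            ≡⟨ cong (_∸ g) (solve 2 (λ W t → W :* ((t :+ con 4) :* (t :+ con 4))
                                                          := W :* (t :* t) :+ W :* (con 8 :* t :+ con 16)) refl W t) ⟩
    (W * (t * t) + W * (8 * t + 16)) ∸ g             ≤⟨ ∸-monoʳ-≤ (W * (t * t) + W * (8 * t + 16)) (<⇒≤ Wt²<g) ⟩
    (W * (t * t) + W * (8 * t + 16)) ∸ W * (t * t)   ≡⟨ m+n∸m≡n (W * (t * t)) _ ⟩
    W * (8 * t + 16)                                 ∎

-- (8 t + 16)² W² ≤ 576 (t² + 1) W², and t² + 1 ≤ g because W t² < g.
size-estimate : ∀ {g t W h s C} → W * (t * t) < g → s ≤ W * suc ((t + 3) * h) → 1 ≤ h → 1 ≤ W → W * W ≤ C →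
  let T = W * (h * h) in g * ((s * s ∸ g * T) * (s * s ∸ g * T)) ≤ (576 * C) * ((g * T) * (g * T))
size-estimate {g} {t} {W} {h} {s} {C} Wt²<g s≤ 1≤h 1≤W W²≤C = begin
  g * ((s * s ∸ g * T) * (s * s ∸ g * T))                  ≤⟨ *-monoʳ-≤ g (*-mono-≤ excess≤ excess≤) ⟩
  g * ((W * (8 * t + 16) * T) * (W * (8 * t + 16) * T))    ≡⟨ regroup g W (8 * t + 16) T ⟩
  (W * W) * ((8 * t + 16) * (8 * t + 16)) * g * (T * T)    ≤⟨ *-monoˡ-≤ (T * T) (*-monoˡ-≤ g (*-mono-≤ W²≤C
                                                               (≤-trans ([8t+16]²≤576[t²+1] t) (*-monoʳ-≤ 576 t²+1≤g)))) ⟩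
  C * (576 * g) * g * (T * T)                              ≡⟨ regroup′ C g T ⟩
  (576 * C) * ((g * T) * (g * T))                          ∎
  where
  open ≤-Reasoning
  open +-*-Solver
  T = W * (h * h)

  excess≤ : s * s ∸ g * T ≤ W * (8 * t + 16) * T
  excess≤ = square-excess {g} {t} {W} {h} {s} Wt²<g s≤ 1≤h

  regroup : ∀ g W a T → g * ((W * a * T) * (W * a * T)) ≡ (W * W) * (a * a) * g * (T * T)
  regroup = solve 4 (λ g W a T → g :* ((W :* a :* T) :* (W :* a :* T)) := (W :* W) :* (a :* a) :* g :* (T :* T)) refl
  regroup′ : ∀ C g T → C * (576 * g) * g * (T * T) ≡ (576 * C) * ((g * T) * (g * T))
  regroup′ = solve 3 (λ C g T → C :* (con 576 :* g) :* g :* (T :* T) := (con 576 :* C) :* ((g :* T) :* (g :* T))) refl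

  t²+1≤g : t * t + 1 ≤ g
  t²+1≤g = ≤-trans (≤-reflexive (+-comm (t * t) 1)) (≤-trans (s≤s (m≤n*m (t * t) W {{>-nonZero 1≤W}})) Wt²<g)

ℕtoℚ≡mkℚ : ∀ a → ℕtoℚ a ≡ mkℚ (ℤ.+ a) 0 (Coprimality.sym (Coprimality.1-coprimeTo a))
ℕtoℚ≡mkℚ a = ℚ.normalize-coprime (Coprimality.sym (Coprimality.1-coprimeTo a))

ℕtoℚ-+ : ∀ a b → ℕtoℚ (a + b) ≡ ℕtoℚ a +ℚ ℕtoℚ b
ℕtoℚ-+ a b = trans (cong (ℚ._/ 1) (sym (cong₂ ℤ._+_ (ℤ.*-identityʳ (ℤ.+ a)) (ℤ.*-identityʳ (ℤ.+ b)))))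
                   (sym (cong₂ _+ℚ_ (ℕtoℚ≡mkℚ a) (ℕtoℚ≡mkℚ b)))

ℕtoℚ-* : ∀ a b → ℕtoℚ (a * b) ≡ ℕtoℚ a *ℚ ℕtoℚ b
ℕtoℚ-* a b = trans (cong (ℚ._/ 1) (ℤ.pos-* a b)) (sym (cong₂ _*ℚ_ (ℕtoℚ≡mkℚ a) (ℕtoℚ≡mkℚ b)))

ℕtoℚ-mono-≤ : ∀ {a b} → a ≤ b → ℕtoℚ a ≤ℚ ℕtoℚ b
ℕtoℚ-mono-≤ {a} {b} a≤b = subst₂ _≤ℚ_ (sym (ℕtoℚ≡mkℚ a)) (sym (ℕtoℚ≡mkℚ b)) (ℚ.*≤* (ℤ.*-monoʳ-≤-nonNeg (ℤ.+ 1) (ℤ.+≤+ a≤b)))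

private
  ℕtoℚ-nonNegative : ∀ a → ℚ.NonNegative (ℕtoℚ a)
  ℕtoℚ-nonNegative a = ℚ.nonNegative (ℕtoℚ-mono-≤ {0} {a} z≤n)

  ℕtoℚ-∸ : ∀ a b → ℕtoℚ a -ℚ ℕtoℚ b ≤ℚ ℕtoℚ (a ∸ b)
  ℕtoℚ-∸ a b with b ≤? a
  ... | yes b≤a = ℚ.≤-reflexive (trans (cong (_-ℚ ℕtoℚ b) (trans (cong ℕtoℚ (sym (m∸n+n≡m b≤a))) (ℕtoℚ-+ (a ∸ b) b)))
                                       (solve 2 (λ x y → (x :+ y) :- y := x) refl (ℕtoℚ (a ∸ b)) (ℕtoℚ b)))
    where open ℚ-Solver
  ... | no  b≰a = ℚ.≤-trans (ℚ.+-monoˡ-≤ (ℚ.- ℕtoℚ b) (ℕtoℚ-mono-≤ a≤b))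
                            (ℚ.≤-reflexive (trans (ℚ.+-inverseʳ (ℕtoℚ b)) (cong ℕtoℚ (sym (m≤n⇒m∸n≡0 a≤b)))))
    where a≤b = <⇒≤ (≰⇒> b≰a)

  εM-nonNegative : ∀ (ε : ℚ) → .{{ℚ.Positive ε}} → ∀ M → 0ℚ ≤ℚ ε *ℚ ℕtoℚ M
  εM-nonNegative ε M = ℚ.nonNegative⁻¹ (ε *ℚ ℕtoℚ M)
    {{ℚ.nonNeg*nonNeg⇒nonNeg ε {{ℚ.pos⇒nonNeg ε}} (ℕtoℚ M) {{ℕtoℚ-nonNegative M}}}}

  square-mono : ∀ {x y} → 0ℚ ≤ℚ x → x ≤ℚ y → x *ℚ x ≤ℚ y *ℚ y
  square-mono {x} {y} 0≤x x≤y = ℚ.≤-trans (ℚ.*-monoˡ-≤-nonNeg x {{ℚ.nonNegative 0≤x}} x≤y)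
                                          (ℚ.*-monoʳ-≤-nonNeg y {{ℚ.nonNegative (ℚ.≤-trans 0≤x x≤y)}} x≤y)

upper-condition : ∀ (E U M g D : ℕ) (ε : ℚ) → ℚ.Positive ε → E ≤ U →
  g * ((U ∸ M) * (U ∸ M)) ≤ D * (M * M) →
  let x = ℕtoℚ E -ℚ (1ℚ +ℚ ε) *ℚ ℕtoℚ M in (x ≤ℚ 0ℚ) ⊎ (ℕtoℚ g *ℚ (x *ℚ x) ≤ℚ ℕtoℚ D *ℚ (ℕtoℚ M *ℚ ℕtoℚ M))
upper-condition E U M g D ε ε>0 E≤U g[U-M]²≤DM² with ℕtoℚ E -ℚ (1ℚ +ℚ ε) *ℚ ℕtoℚ M ℚ.≤? 0ℚ
... | yes x≤0 = inj₁ x≤0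
... | no  x≰0 = inj₂ (begin
  ℕtoℚ g *ℚ (x *ℚ x)                                ≤⟨ ℚ.*-monoˡ-≤-nonNeg (ℕtoℚ g) {{ℕtoℚ-nonNegative g}} (square-mono 0≤x x≤U-M) ⟩
  ℕtoℚ g *ℚ (ℕtoℚ (U ∸ M) *ℚ ℕtoℚ (U ∸ M))          ≡⟨ ℕtoℚ-*-square g (U ∸ M) ⟨
  ℕtoℚ (g * ((U ∸ M) * (U ∸ M)))                    ≤⟨ ℕtoℚ-mono-≤ g[U-M]²≤DM² ⟩
  ℕtoℚ (D * (M * M))                                ≡⟨ ℕtoℚ-*-square D M ⟩
  ℕtoℚ D *ℚ (ℕtoℚ M *ℚ ℕtoℚ M)                      ∎)
  where
  open ℚ.≤-Reasoning
  instance _ = ε>0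
  ℕtoℚ-*-square : ∀ a b → ℕtoℚ (a * (b * b)) ≡ ℕtoℚ a *ℚ (ℕtoℚ b *ℚ ℕtoℚ b)
  ℕtoℚ-*-square a b = trans (ℕtoℚ-* a (b * b)) (cong (ℕtoℚ a *ℚ_) (ℕtoℚ-* b b))

  x = ℕtoℚ E -ℚ (1ℚ +ℚ ε) *ℚ ℕtoℚ M

  0≤x : 0ℚ ≤ℚ x
  0≤x = ℚ.<⇒≤ (ℚ.≰⇒> x≰0)

  M≤[1+ε]M : ℕtoℚ M ≤ℚ (1ℚ +ℚ ε) *ℚ ℕtoℚ M
  M≤[1+ε]M = ℚ.≤-trans (ℚ.≤-reflexive (sym (ℚ.+-identityʳ (ℕtoℚ M))))
               (ℚ.≤-trans (ℚ.+-monoʳ-≤ (ℕtoℚ M) (εM-nonNegative ε M))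
                 (ℚ.≤-reflexive (solve 2 (λ ε M → M :+ ε :* M := (con 1ℚ :+ ε) :* M) refl ε (ℕtoℚ M))))
    where open ℚ-Solver

  x≤U-M : x ≤ℚ ℕtoℚ (U ∸ M)
  x≤U-M = ℚ.≤-trans (ℚ.+-monoʳ-≤ (ℕtoℚ E) (ℚ.neg-antimono-≤ M≤[1+ε]M))
            (ℚ.≤-trans (ℚ.+-monoˡ-≤ (ℚ.- ℕtoℚ M) (ℕtoℚ-mono-≤ E≤U)) (ℕtoℚ-∸ U M))

lower-condition : ∀ (E M : ℕ) (ε : ℚ) → ℚ.Positive ε → M ≤ E → (1ℚ -ℚ ε) *ℚ ℕtoℚ M -ℚ ℕtoℚ E ≤ℚ 0ℚ
lower-condition E M ε ε>0 M≤E = ℚ.≤-trans (ℚ.+-monoˡ-≤ (ℚ.- ℕtoℚ E) (ℚ.≤-trans [1-ε]M≤M (ℕtoℚ-mono-≤ M≤E)))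
                                          (ℚ.≤-reflexive (ℚ.+-inverseʳ (ℕtoℚ E)))
  where
  instance _ = ε>0
  [1-ε]M≤M : (1ℚ -ℚ ε) *ℚ ℕtoℚ M ≤ℚ ℕtoℚ M
  [1-ε]M≤M = ℚ.≤-trans (ℚ.≤-reflexive (solve 2 (λ ε M → (con 1ℚ :- ε) :* M := M :+ (:- (ε :* M))) refl ε (ℕtoℚ M)))
               (ℚ.≤-trans (ℚ.+-monoʳ-≤ (ℕtoℚ M) (ℚ.neg-antimono-≤ (εM-nonNegative ε M))) (ℚ.≤-reflexive (ℚ.+-identityʳ (ℕtoℚ M))))
    where open ℚ-Solver

module AbelianGroupLemmas {A : Set} {_∙_ : Op₂ A} {ε : A} {_⁻¹ : Op₁ A}
                          (isAbelianGroup : IsAbelianGroup _≡_ _∙_ ε _⁻¹) where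

  G : AbelianGroup _ _
  G = record { isAbelianGroup = isAbelianGroup }

  open IsAbelianGroup isAbelianGroup public
    using (_-_; assoc; comm; identityˡ; identityʳ; inverseˡ; inverseʳ)
  open AbelianGroupProperties G public
    using (ε⁻¹≈ε; ⁻¹-involutive; x∙y⁻¹≈ε⇒x≈y; ⁻¹-∙-comm; //-rightDividesˡ; //-rightDividesʳ;
           identityʳ-unique; inverseˡ-unique)
  open CommutativeSemigroupProperties (AbelianGroup.commutativeSemigroup G) public
    using (interchange; x∙yz≈y∙xz)
  open ≡-Reasoning

  x-ε≡x : ∀ x → x - ε ≡ x
  x-ε≡x x = trans (cong (x ∙_) ε⁻¹≈ε) (identityʳ x)

  -‿distrib-∙ : ∀ a b c d → (a ∙ b) - (c ∙ d) ≡ (a - c) ∙ (b - d)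
  -‿distrib-∙ a b c d = trans (cong ((a ∙ b) ∙_) (sym (⁻¹-∙-comm c d))) (interchange a b (c ⁻¹) (d ⁻¹))

  ⁻¹-distrib-- : ∀ a b → (a - b) ⁻¹ ≡ a ⁻¹ - b ⁻¹
  ⁻¹-distrib-- a b = sym (⁻¹-∙-comm a (b ⁻¹))

  -‿chain : ∀ x y z → (x - y) ∙ (y - z) ≡ x - z
  -‿chain x y z = trans (sym (assoc (x - y) y (z ⁻¹))) (cong (_- z) (//-rightDividesˡ y x))

  -‿exchange : ∀ {a b a′ b′} → a - b ≡ a′ - b′ → a - a′ ≡ b - b′
  -‿exchange {a} {b} {a′} {b′} eq = begin
    a - a′                 ≡⟨ -‿chain a b a′ ⟨
    (a - b) ∙ (b - a′)     ≡⟨ cong (_∙ (b - a′)) eq ⟩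
    (a′ - b′) ∙ (b - a′)   ≡⟨ comm (a′ - b′) (b - a′) ⟩
    (b - a′) ∙ (a′ - b′)   ≡⟨ -‿chain b a′ b′ ⟩
    b - b′                 ∎

module FiniteAbelianGroup (m : ℕ) (_∙_ : Op₂ (Fin m)) (ε : Fin m) (_⁻¹ : Op₁ (Fin m))
                          (isAbelianGroup : IsAbelianGroup _≡_ _∙_ ε _⁻¹) where

  open FinGroup m _∙_ _⁻¹ public

  module Gᴸ = AbelianGroupLemmas isAbelianGroup
  open Gᴸ using (_-_; assoc; comm; identityˡ; identityʳ; inverseˡ; inverseʳ)
  open import Algebra.Properties.Monoid.Mult (AbelianGroup.monoid Gᴸ.G)
    using (×-assocˡ; ×-homo-+) renaming (_×_ to infixr 8 _·_)

  0ᵛ : ∀ {n} → El n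
  0ᵛ {n} = replicate n ε

  negᵛ : ∀ {n} → El n → El n
  negᵛ = mapᵛ _⁻¹

  ⊕-isAbelianGroup : ∀ n → IsAbelianGroup _≡_ (_⊕_ {n}) 0ᵛ negᵛ
  ⊕-isAbelianGroup n = record
    { isGroup = record
      { isMonoid = record
        { isSemigroup = record
          { isMagma = record { isEquivalence = isEquivalence ; ∙-cong = cong₂ _⊕_ }
          ; assoc = zipWith-assoc assoc }
        ; identity = zipWith-identityˡ identityˡ , zipWith-identityʳ identityʳ }
      ; inverse = zipWith-inverseˡ inverseˡ , zipWith-inverseʳ inverseʳ
      ; ⁻¹-cong = cong negᵛ }
    ; comm = zipWith-comm comm }

  module Vᴸ {n} = AbelianGroupLemmas (⊕-isAbelianGroup n)

  ⊕-++ : ∀ {a b} (x : El a) (y : El b) x′ y′ → (x ++ y) ⊕ (x′ ++ y′) ≡ (x ⊕ x′) ++ (y ⊕ y′)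
  ⊕-++ = zipWith-++ _∙_

  ⊖-++ : ∀ {a b} (x : El a) (y : El b) x′ y′ → (x ++ y) ⊖ (x′ ++ y′) ≡ (x ⊖ x′) ++ (y ⊖ y′)
  ⊖-++ x y x′ y′ = trans (cong ((x ++ y) ⊕_) (map-++ _⁻¹ x′ y′)) (⊕-++ x y (negᵛ x′) (negᵛ y′))

  0ᵛ-++ : ∀ a {b} → 0ᵛ {a + b} ≡ 0ᵛ {a} ++ 0ᵛ {b}
  0ᵛ-++ zero    = refl
  0ᵛ-++ (suc a) = cong (ε ∷_) (0ᵛ-++ a)

  ⊖-homomorphism⇒0ᵛ↦0ᵛ : ∀ {a b} (f : El a → El b) → (∀ x y → f (x ⊖ y) ≡ f x ⊖ f y) → f 0ᵛ ≡ 0ᵛ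
  ⊖-homomorphism⇒0ᵛ↦0ᵛ f f-⊖ = begin
    f 0ᵛ          ≡⟨ cong f (Vᴸ.inverseʳ 0ᵛ) ⟨
    f (0ᵛ ⊖ 0ᵛ)   ≡⟨ f-⊖ 0ᵛ 0ᵛ ⟩
    f 0ᵛ ⊖ f 0ᵛ   ≡⟨ Vᴸ.inverseʳ (f 0ᵛ) ⟩
    0ᵛ            ∎
    where open ≡-Reasoning

  elements : ∀ n → List (El n)
  elements zero    = [ [] ]
  elements (suc n) = cartesianProductWith _∷_ (allFin m) (elements n)

  elements-unique : ∀ n → Unique (elements n)
  elements-unique zero    = All.[] ∷ []
  elements-unique (suc n) = cartesianProductWith⁺ _∷_ ∷-injective (allFin⁺ m) (elements-unique n)

  ∈-elements : ∀ {n} (x : El n) → x ∈ elements n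
  ∈-elements []      = here refl
  ∈-elements (c ∷ x) = ∈-cartesianProductWith⁺ _∷_ (∈-allFin c) (∈-elements x)

  length-elements : ∀ n → length (elements n) ≡ m ^ n
  length-elements zero    = refl
  length-elements (suc n) = trans (length-cartesianProductWith _∷_ (allFin m) (elements n))
    (cong₂ _*_ (length-tabulate {n = m} (λ i → i)) (length-elements n))

  reps : ∀ {n} → (El n → El n → El n) → List (El n) → El n → ℕ
  reps _op_ A x = length (filter (λ p → (proj₁ p op proj₂ p) ≟ x) (cartesianProduct A A))

  g-basis⇒g·mⁿ≤size² : ∀ {n g} (_op_ : El n → El n → El n) (A : List (El n)) →
    (∀ x → g ≤ reps _op_ A x) → g * m ^ n ≤ length A * length A
  g-basis⇒g·mⁿ≤size² {n} {g} _op_ A g≤reps = begin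
    g * m ^ n                            ≡⟨ cong (g *_) (length-elements n) ⟨
    g * length (elements n)              ≤⟨ sum-map-≥ (reps _op_ A) (elements n) g≤reps ⟩
    sum (map (reps _op_ A) (elements n)) ≡⟨ sum-length-fibres _≟_ (λ p → proj₁ p op proj₂ p) (cartesianProduct A A)
                                             (elements-unique n) ∈-elements ⟩
    length (cartesianProduct A A)        ≡⟨ length-cartesianProductWith _,_ A A ⟩
    length A * length A                  ∎
    where open ≤-Reasoning

  record Spread (R d : ℕ) : Set where
    field
      part             : Fin R → List (El d)
      size             : ℕ
      size²≡mᵈ         : size * size ≡ m ^ d
      length-part      : ∀ i → length (part i) ≡ size
      part-unique      : ∀ i → Unique (part i)
      0ᵛ∈part          : ∀ i → 0ᵛ ∈ part i
      part-closed      : ∀ i {a b} → a ∈ part i → b ∈ part i → a ⊖ b ∈ part i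
      parts-meet-in-0ᵛ : ∀ {i j a} → i ≢ j → a ∈ part i → a ∈ part j → a ≡ 0ᵛ

  module _ {R d} (S : Spread R d) where
    open Spread S

    negᵛ∈part : ∀ i {a} → a ∈ part i → negᵛ a ∈ part i
    negᵛ∈part i {a} a∈ = subst (_∈ part i) (Vᴸ.identityˡ (negᵛ a)) (part-closed i (0ᵛ∈part i) a∈)

    -- The m ^ d differences a ⊖ b are pairwise distinct, hence exhaust G^d.
    parts-cover : ∀ {i j} → i ≢ j → ∀ z → ∃₂ λ a b → a ∈ part i × b ∈ part j × a ⊖ b ≡ z
    parts-cover {i} {j} i≢j z =
      let (a , b) , ab∈ , z≡a-b = ∈-map⁻ difference (elements⊆differences (∈-elements z))
          a∈ , b∈ = ∈-cartesianProduct⁻ (part i) (part j) ab∈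
      in a , b , a∈ , b∈ , sym z≡a-b
      where
      pairs = cartesianProduct (part i) (part j)

      difference : El d × El d → El d
      difference (a , b) = a ⊖ b

      difference-injective : ∀ {p q} → p ∈ pairs → q ∈ pairs → difference p ≡ difference q → p ≡ q
      difference-injective {a , b} {a′ , b′} p∈ q∈ a-b≡a′-b′ =
        let a∈ , b∈   = ∈-cartesianProduct⁻ (part i) (part j) p∈
            a′∈ , b′∈ = ∈-cartesianProduct⁻ (part i) (part j) q∈
            a-a′≡b-b′ = Vᴸ.-‿exchange a-b≡a′-b′
            a-a′≡0 = parts-meet-in-0ᵛ i≢j (part-closed i a∈ a′∈)
                       (subst (_∈ part j) (sym a-a′≡b-b′) (part-closed j b∈ b′∈))
        in cong₂ _,_ (Vᴸ.x∙y⁻¹≈ε⇒x≈y a a′ a-a′≡0) (Vᴸ.x∙y⁻¹≈ε⇒x≈y b b′ (trans (sym a-a′≡b-b′) a-a′≡0))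

      length-differences : length (map difference pairs) ≡ m ^ d
      length-differences = trans (length-map difference pairs)
        (trans (length-cartesianProductWith _,_ (part i) (part j))
          (trans (cong₂ _*_ (length-part i) (length-part j)) size²≡mᵈ))

      elements⊆differences : ∀ {z} → z ∈ elements d → z ∈ map difference pairs
      elements⊆differences = ⊆∧length≥⇒⊇ _≟_
        (unique-map-injectiveOn (cartesianProduct⁺ (part-unique i) (part-unique j)) difference-injective)
        (λ _ → ∈-elements _)
        (≤-reflexive (trans (length-elements d) (sym length-differences)))

  trivial-spread : ∀ R → Spread R 0
  trivial-spread R = record
    { part             = λ _ → [ [] ]
    ; size             = 1
    ; size²≡mᵈ         = refl
    ; length-part      = λ _ → refl
    ; part-unique      = λ _ → All.[] ∷ []
    ; 0ᵛ∈part          = λ _ → here refl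
    ; part-closed      = λ { _ {[]} {[]} _ _ → here refl }
    ; parts-meet-in-0ᵛ = λ { {a = []} _ _ _ → refl }
    }

  _⊗_ : ∀ {R d₁ d₂} → Spread R d₁ → Spread R d₂ → Spread R (d₁ + d₂)
  _⊗_ {R} {d₁} {d₂} S₁ S₂ = record
    { part             = part
    ; size             = S₁.size * S₂.size
    ; size²≡mᵈ         = trans (square-* S₁.size S₂.size)
                           (trans (cong₂ _*_ S₁.size²≡mᵈ S₂.size²≡mᵈ) (sym (^-distribˡ-+-* m d₁ d₂)))
    ; length-part      = λ i → trans (length-cartesianProductWith _++_ (S₁.part i) (S₂.part i))
                                 (cong₂ _*_ (S₁.length-part i) (S₂.length-part i))
    ; part-unique      = λ i → cartesianProductWith⁺ _++_ (λ {w} {x} → ++-injective w x)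
                                 (S₁.part-unique i) (S₂.part-unique i)
    ; 0ᵛ∈part          = λ i → subst (_∈ part i) (sym (0ᵛ-++ d₁))
                                 (∈-cartesianProductWith⁺ _++_ (S₁.0ᵛ∈part i) (S₂.0ᵛ∈part i))
    ; part-closed      = part-closed
    ; parts-meet-in-0ᵛ = parts-meet-in-0ᵛ
    }
    where
    module S₁ = Spread S₁
    module S₂ = Spread S₂

    square-* : ∀ a b → a * b * (a * b) ≡ a * a * (b * b)
    square-* = solve 2 (λ a b → a :* b :* (a :* b) := a :* a :* (b :* b)) refl
      where open +-*-Solver

    part : Fin R → List (El (d₁ + d₂))
    part i = cartesianProductWith _++_ (S₁.part i) (S₂.part i)

    part-closed : ∀ i {a b} → a ∈ part i → b ∈ part i → a ⊖ b ∈ part i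
    part-closed i a∈ b∈
      with a₁ , a₂ , a₁∈ , a₂∈ , refl ← ∈-cartesianProductWith⁻ _++_ (S₁.part i) (S₂.part i) a∈
         | b₁ , b₂ , b₁∈ , b₂∈ , refl ← ∈-cartesianProductWith⁻ _++_ (S₁.part i) (S₂.part i) b∈
      = subst (_∈ part i) (sym (⊖-++ a₁ a₂ b₁ b₂))
          (∈-cartesianProductWith⁺ _++_ (S₁.part-closed i a₁∈ b₁∈) (S₂.part-closed i a₂∈ b₂∈))

    parts-meet-in-0ᵛ : ∀ {i j a} → i ≢ j → a ∈ part i → a ∈ part j → a ≡ 0ᵛ
    parts-meet-in-0ᵛ {i} {j} i≢j a∈i a∈j
      with a₁ , a₂ , a₁∈ , a₂∈ , refl ← ∈-cartesianProductWith⁻ _++_ (S₁.part i) (S₂.part i) a∈i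
         | b₁ , b₂ , b₁∈ , b₂∈ , a≡b ← ∈-cartesianProductWith⁻ _++_ (S₁.part j) (S₂.part j) a∈j
      = let a₁≡b₁ , a₂≡b₂ = ++-injective a₁ b₁ a≡b
        in trans (cong₂ _++_ (S₁.parts-meet-in-0ᵛ i≢j a₁∈ (subst (_∈ S₁.part j) (sym a₁≡b₁) b₁∈))
                             (S₂.parts-meet-in-0ᵛ i≢j a₂∈ (subst (_∈ S₂.part j) (sym a₂≡b₂) b₂∈)))
                 (sym (0ᵛ-++ d₁))

  _⊗^_ : ∀ {R d} → Spread R d → ∀ k → Spread R (k * d)
  S ⊗^ zero    = trivial-spread _
  S ⊗^ suc k = S ⊗ (S ⊗^ k)

  n·ε≡ε : ∀ n → n · ε ≡ ε
  n·ε≡ε zero    = refl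
  n·ε≡ε (suc n) = trans (identityˡ (n · ε)) (n·ε≡ε n)

  ·-∣ : ∀ {d n c} → d · c ≡ ε → d ∣ n → n · c ≡ ε
  ·-∣ {d} {c = c} d·c≡ε (divides t refl) = trans (sym (×-assocˡ c t d)) (trans (cong (t ·_) d·c≡ε) (n·ε≡ε t))

  order-bounded : ∀ c → ∃ λ d → 1 ≤ d × d ≤ m × d · c ≡ ε
  order-bounded c with i , j , i<j , i·c≡j·c ← pigeonhole (n<1+n m) (λ i → toℕ i · c) =
    toℕ j ∸ toℕ i , m<n⇒0<n∸m i<j , ≤-trans (m∸n≤m (toℕ j) (toℕ i)) (toℕ≤pred[n] j) ,
    Gᴸ.identityʳ-unique (toℕ i · c) _ (begin
      (toℕ i · c) ∙ ((toℕ j ∸ toℕ i) · c) ≡⟨ ×-homo-+ c (toℕ i) (toℕ j ∸ toℕ i) ⟨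
      (toℕ i + (toℕ j ∸ toℕ i)) · c   ≡⟨ cong (_· c) (m+[n∸m]≡n (<⇒≤ i<j)) ⟩
      toℕ j · c                       ≡⟨ i·c≡j·c ⟨
      toℕ i · c                       ∎)
    where open ≡-Reasoning

  adjacent-annihilators : ∀ {a b c} → suc a ≡ b → a · c ≡ ε → b · c ≡ ε → c ≡ ε
  adjacent-annihilators {a} {c = c} refl a·c≡ε b·c≡ε = begin
    c           ≡⟨ identityʳ c ⟨
    c ∙ ε       ≡⟨ cong (c ∙_) a·c≡ε ⟨
    c ∙ (a · c) ≡⟨ b·c≡ε ⟩
    ε           ∎
    where open ≡-Reasoning

  sumᵛ : ∀ {k} → El k → Fin m
  sumᵛ []       = ε
  sumᵛ (x ∷ xs) = x ∙ sumᵛ xs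

  sumᵛ-⊖ : ∀ {k} (a b : El k) → sumᵛ (a ⊖ b) ≡ sumᵛ a - sumᵛ b
  sumᵛ-⊖ []       []       = sym (inverseʳ ε)
  sumᵛ-⊖ (a ∷ as) (b ∷ bs) = trans (cong ((a - b) ∙_) (sumᵛ-⊖ as bs)) (sym (Gᴸ.-‿distrib-∙ a (sumᵛ as) b (sumᵛ bs)))

  sumᵛ-replicate : ∀ k c → sumᵛ (replicate k c) ≡ k · c
  sumᵛ-replicate zero    c = refl
  sumᵛ-replicate (suc k) c = cong (c ∙_) (sumᵛ-replicate k c)

  sumᵛ-rotate^ : ∀ {k} c (y : El (suc k)) → sumᵛ (rotate^ c y) ≡ sumᵛ y
  sumᵛ-rotate^ zero    y        = refl
  sumᵛ-rotate^ (suc c) (x ∷ xs) = trans (sumᵛ-rotate^ c (xs ∷ʳ x)) (sumᵛ-∷ʳ xs)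
    where
    sumᵛ-∷ʳ : ∀ {k} (xs : El k) → sumᵛ (xs ∷ʳ x) ≡ x ∙ sumᵛ xs
    sumᵛ-∷ʳ []       = refl
    sumᵛ-∷ʳ (y ∷ xs) = trans (cong (y ∙_) (sumᵛ-∷ʳ xs)) (Gᴸ.x∙yz≈y∙xz y x (sumᵛ xs))

  rotate^-⊖ : ∀ {k} c (a b : El (suc k)) → rotate^ c (a ⊖ b) ≡ rotate^ c a ⊖ rotate^ c b
  rotate^-⊖ c a b = trans (rotate^-zipWith _∙_ c a (negᵛ b)) (cong (rotate^ c a ⊕_) (rotate^-map _⁻¹ c b))

  embed : ∀ {k} → El k → El (suc k)
  embed v = sumᵛ v ⁻¹ ∷ v

  sumᵛ-embed : ∀ {k} (v : El k) → sumᵛ (embed v) ≡ ε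
  sumᵛ-embed v = inverseˡ (sumᵛ v)

  embed-⊖ : ∀ {k} (a b : El k) → embed (a ⊖ b) ≡ embed a ⊖ embed b
  embed-⊖ a b = cong (_∷ (a ⊖ b)) (trans (cong _⁻¹ (sumᵛ-⊖ a b)) (Gᴸ.⁻¹-distrib-- (sumᵛ a) (sumᵛ b)))

  sumᵛ≡ε⇒embed-tail : ∀ {k} {y : El (suc k)} → sumᵛ y ≡ ε → embed (tail y) ≡ y
  sumᵛ≡ε⇒embed-tail {y = x ∷ xs} sum≡ε = cong (_∷ xs) (sym (Gᴸ.inverseˡ-unique x (sumᵛ xs) sum≡ε))

  -- As P = k + 1 ± 1 and the shift has period k + 1, y is fixed by the shift itself, so it is
  -- constant; its entry is annihilated by both k + 1 and P, hence by their difference 1.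
  rotate^-fixed⇒0ᵛ : ∀ {k P} → (∀ c → P · c ≡ ε) → suc P ≡ suc k ⊎ suc (suc k) ≡ P →
    ∀ {y : El (suc k)} → sumᵛ y ≡ ε → rotate^ P y ≡ y → y ≡ 0ᵛ
  rotate^-fixed⇒0ᵛ {k} {P} P-annihilates adjacent {y} sum≡ε fixed =
    let c , y≡cᵏ⁺¹ = rotate-fixed⇒replicate (rotate-fixed adjacent)
        1+k·c≡ε = trans (sym (sumᵛ-replicate (suc k) c)) (trans (cong sumᵛ (sym y≡cᵏ⁺¹)) sum≡ε)
    in trans y≡cᵏ⁺¹ (cong (replicate (suc k)) (c≡ε adjacent (P-annihilates c) 1+k·c≡ε))
    where
    open ≡-Reasoning
    rotate-fixed : suc P ≡ suc k ⊎ suc (suc k) ≡ P → rotate y ≡ y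
    rotate-fixed (inj₁ 1+P≡1+k) = begin
      rotate y                ≡⟨ cong rotate fixed ⟨
      rotate (rotate^ P y)    ≡⟨ rotate^-+ P 1 y ⟨
      rotate^ (P + 1) y       ≡⟨ cong (λ n → rotate^ n y) (trans (+-comm P 1) 1+P≡1+k) ⟩
      rotate^ (suc k) y       ≡⟨ rotate^-period y ⟩
      y                       ∎
    rotate-fixed (inj₂ 2+k≡P) = begin
      rotate y                     ≡⟨ cong rotate (rotate^-period y) ⟨
      rotate (rotate^ (suc k) y)   ≡⟨ rotate^-+ (suc k) 1 y ⟨
      rotate^ (suc k + 1) y        ≡⟨ cong (λ n → rotate^ n y) (trans (+-comm (suc k) 1) 2+k≡P) ⟩
      rotate^ P y                  ≡⟨ fixed ⟩
      y                            ∎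
    c≡ε : ∀ {c} → suc P ≡ suc k ⊎ suc (suc k) ≡ P → P · c ≡ ε → suc k · c ≡ ε → c ≡ ε
    c≡ε (inj₁ 1+P≡1+k) P·c≡ε 1+k·c≡ε = adjacent-annihilators 1+P≡1+k P·c≡ε 1+k·c≡ε
    c≡ε (inj₂ 2+k≡P)   P·c≡ε 1+k·c≡ε = adjacent-annihilators 2+k≡P 1+k·c≡ε P·c≡ε

  -- Λ c is the c-th power of the cyclic shift on the sum-zero subgroup of G^(k+1) ≅ G^k.
  Λ : ∀ {k} → ℕ → El k → El k
  Λ c v = tail (rotate^ c (embed v))

  Λ-⊖ : ∀ {k} c (a b : El k) → Λ c (a ⊖ b) ≡ Λ c a ⊖ Λ c b
  Λ-⊖ c a b = trans (cong (λ y → tail (rotate^ c y)) (embed-⊖ a b))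
    (trans (cong tail (rotate^-⊖ c (embed a) (embed b))) (tail-⊖ (rotate^ c (embed a)) (rotate^ c (embed b))))
    where
    tail-⊖ : ∀ {k} (x y : El (suc k)) → tail (x ⊖ y) ≡ tail x ⊖ tail y
    tail-⊖ (_ ∷ _) (_ ∷ _) = refl

  Λ-separates : ∀ {k P} → (∀ c → P · c ≡ ε) → suc P ≡ suc k ⊎ suc (suc k) ≡ P →
    ∀ {c c′} → c < c′ → (c′ ∸ c) ∣ P → ∀ {v : El k} → Λ c v ≡ Λ c′ v → v ≡ 0ᵛ
  Λ-separates {k} P-annihilates adjacent {c} {c′} c<c′ c′-c∣P {v} Λcv≡Λc′v = begin
    v                          ≡⟨⟩
    tail (embed v)             ≡⟨ cong tail (rotate^-injective c (trans y≡0 (sym rotate^-0ᵛ))) ⟩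
    tail 0ᵛ                    ≡⟨⟩
    0ᵛ                         ∎
    where
    open ≡-Reasoning
    y = rotate^ c (embed v)

    sumy≡ε : sumᵛ y ≡ ε
    sumy≡ε = trans (sumᵛ-rotate^ c (embed v)) (sumᵛ-embed v)

    rotate^-0ᵛ : rotate^ c (0ᵛ {suc k}) ≡ 0ᵛ
    rotate^-0ᵛ = ⊖-homomorphism⇒0ᵛ↦0ᵛ (rotate^ c) (rotate^-⊖ c)

    y′≡y : rotate^ (c′ ∸ c) y ≡ y
    y′≡y = begin
      rotate^ (c′ ∸ c) y           ≡⟨ rotate^-+ c (c′ ∸ c) (embed v) ⟨
      rotate^ (c + (c′ ∸ c)) (embed v) ≡⟨ cong (λ n → rotate^ n (embed v)) (m+[n∸m]≡n (<⇒≤ c<c′)) ⟩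
      rotate^ c′ (embed v)         ≡⟨ sumᵛ≡ε⇒embed-tail (trans (sumᵛ-rotate^ c′ (embed v)) (sumᵛ-embed v)) ⟨
      embed (Λ c′ v)               ≡⟨ cong embed Λcv≡Λc′v ⟨
      embed (Λ c v)                ≡⟨ sumᵛ≡ε⇒embed-tail sumy≡ε ⟩
      y                            ∎

    y≡0 : y ≡ 0ᵛ
    y≡0 = rotate^-fixed⇒0ᵛ P-annihilates adjacent sumy≡ε (rotate^-∣ y′≡y c′-c∣P)

  module _ {k P R′} (P-annihilates : ∀ c → P · c ≡ ε) (adjacent : suc P ≡ suc k ⊎ suc (suc k) ≡ P)
           (small-divisors : ∀ d → 1 ≤ d → d < R′ → d ∣ P) where

    private
      Λ-separates-Fin : ∀ {t t′ : Fin R′} → t ≢ t′ → ∀ {v} → Λ (toℕ t) v ≡ Λ (toℕ t′) v → v ≡ 0ᵛ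
      Λ-separates-Fin {t} {t′} t≢t′ eq with <-cmp (toℕ t) (toℕ t′)
      ... | tri< t<t′ _ _ = Λ-separates P-annihilates adjacent t<t′
              (small-divisors _ (m<n⇒0<n∸m t<t′) (≤-<-trans (m∸n≤m (toℕ t′) (toℕ t)) (toℕ<n t′))) eq
      ... | tri≈ _ t≡t′ _ = ⊥-elim (t≢t′ (toℕ-injective t≡t′))
      ... | tri> _ _ t>t′ = Λ-separates P-annihilates adjacent t>t′
              (small-divisors _ (m<n⇒0<n∸m t>t′) (≤-<-trans (m∸n≤m (toℕ t) (toℕ t′)) (toℕ<n t))) (sym eq)

    Φ : Fin (suc R′) → El k → El (k + k)
    Φ fzero    v = 0ᵛ ++ v
    Φ (fsuc t) v = v ++ Λ (toℕ t) v

    Φ-injective : ∀ i {v v′} → Φ i v ≡ Φ i v′ → v ≡ v′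
    Φ-injective fzero          = ++-injectiveʳ 0ᵛ 0ᵛ
    Φ-injective (fsuc t) {v} {v′} = ++-injectiveˡ v v′

    Φ-⊖ : ∀ i v v′ → Φ i (v ⊖ v′) ≡ Φ i v ⊖ Φ i v′
    Φ-⊖ fzero    v v′ = trans (cong (_++ (v ⊖ v′)) (sym (Vᴸ.inverseʳ 0ᵛ))) (sym (⊖-++ 0ᵛ v 0ᵛ v′))
    Φ-⊖ (fsuc t) v v′ = trans (cong ((v ⊖ v′) ++_) (Λ-⊖ (toℕ t) v v′)) (sym (⊖-++ v _ v′ _))

    Φ-0ᵛ : ∀ i → Φ i 0ᵛ ≡ 0ᵛ
    Φ-0ᵛ i = ⊖-homomorphism⇒0ᵛ↦0ᵛ (Φ i) (Φ-⊖ i)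

    Φ-meet : ∀ {i j} → i ≢ j → ∀ {v v′} → Φ i v ≡ Φ j v′ → v ≡ 0ᵛ
    Φ-meet {fzero}  {fzero}   0≢0 _ = ⊥-elim (0≢0 refl)
    Φ-meet {fzero}  {fsuc t′} _ {v} {v′} eq =
      let 0≡v′ , v≡Λv′ = ++-injective 0ᵛ v′ eq
      in trans v≡Λv′ (trans (cong (Λ (toℕ t′)) (sym 0≡v′)) (⊖-homomorphism⇒0ᵛ↦0ᵛ (Λ (toℕ t′)) (Λ-⊖ (toℕ t′))))
    Φ-meet {fsuc t} {fzero}   _ {v} eq = proj₁ (++-injective v 0ᵛ eq)
    Φ-meet {fsuc t} {fsuc t′} i≢j {v} {v′} eq =
      let v≡v′ , Λv≡Λv′ = ++-injective v v′ eq
      in Λ-separates-Fin (λ t≡t′ → i≢j (cong fsuc t≡t′)) (trans Λv≡Λv′ (cong (Λ (toℕ t′)) (sym v≡v′)))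

    base-spread : Spread (suc R′) (k + k)
    base-spread = record
      { part             = part
      ; size             = m ^ k
      ; size²≡mᵈ         = sym (^-distribˡ-+-* m k k)
      ; length-part      = λ i → trans (length-map (Φ i) (elements k)) (length-elements k)
      ; part-unique      = λ i → map⁺ (Φ-injective i) (elements-unique k)
      ; 0ᵛ∈part          = λ i → subst (_∈ part i) (Φ-0ᵛ i) (∈-map⁺ (Φ i) (∈-elements 0ᵛ))
      ; part-closed      = part-closed
      ; parts-meet-in-0ᵛ = parts-meet-in-0ᵛ
      }
      where
      part : Fin (suc R′) → List (El (k + k))
      part i = map (Φ i) (elements k)

      part-closed : ∀ i {a b} → a ∈ part i → b ∈ part i → a ⊖ b ∈ part i
      part-closed i a∈ b∈ with v , _ , refl ← ∈-map⁻ (Φ i) a∈ | v′ , _ , refl ← ∈-map⁻ (Φ i) b∈ =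
        subst (_∈ part i) (Φ-⊖ i v v′) (∈-map⁺ (Φ i) (∈-elements (v ⊖ v′)))

      parts-meet-in-0ᵛ : ∀ {i j a} → i ≢ j → a ∈ part i → a ∈ part j → a ≡ 0ᵛ
      parts-meet-in-0ᵛ {i} {j} i≢j a∈i a∈j with v , _ , refl ← ∈-map⁻ (Φ i) a∈i | v′ , _ , Φiv≡Φjv′ ← ∈-map⁻ (Φ j) a∈j =
        trans (cong (Φ i) (Φ-meet i≢j Φiv≡Φjv′)) (Φ-0ᵛ i)

  module _ {R′ d} (S : Spread (suc R′) d) (w : ℕ) where

    open Spread S
    open import Data.List.Membership.DecPropositional (_≟_ {d}) using (_∈?_)

    private
      R = suc R′

      nonzero? : (a : El d) → Dec (a ≢ 0ᵛ)
      nonzero? a = ¬? (a ≟ 0ᵛ)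

      part* : Fin R → List (El d)
      part* i = filter nonzero? (part i)

    U : List (El d)
    U = 0ᵛ ∷ concatMap part* (allFin R)

    spread-basis : List (El (w + d))
    spread-basis = cartesianProductWith _++_ (elements w) U

    private
      ∈-part*⁻ : ∀ {i a} → a ∈ part* i → a ∈ part i × a ≢ 0ᵛ
      ∈-part*⁻ = ∈-filter⁻ nonzero?

    part⊆U : ∀ {i a} → a ∈ part i → a ∈ U
    part⊆U {i} {a} a∈ = [ here , (λ a≢0 → there (∈-concatMap⁺ part* (lose (∈-allFin i) (∈-filter⁺ nonzero? a∈ a≢0)))) ]′
                          (toSum (a ≟ 0ᵛ))

    U-unique : Unique U
    U-unique = All.tabulate (λ a∈ 0≡a → let _ , _ , a∈i = find (∈-concatMap⁻ part* {xs = allFin R} a∈)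
                                        in proj₂ (∈-part*⁻ a∈i) (sym 0≡a))
             ∷ unique-concatMap part* (allFin⁺ R) (λ i → filter⁺ nonzero? (part-unique i))
                 (λ i≢j (a∈i , a∈j) → proj₂ (∈-part*⁻ a∈i) (parts-meet-in-0ᵛ i≢j (proj₁ (∈-part*⁻ a∈i)) (proj₁ (∈-part*⁻ a∈j))))

    spread-basis-unique : Unique spread-basis
    spread-basis-unique = cartesianProductWith⁺ _++_ (λ {a} {b} → ++-injective a b) (elements-unique w) U-unique

    length-spread-basis : length spread-basis ≤ m ^ w * suc (R * size)
    length-spread-basis = begin
      length spread-basis            ≡⟨ length-cartesianProductWith _++_ (elements w) U ⟩
      length (elements w) * length U ≡⟨ cong (_* length U) (length-elements w) ⟩
      m ^ w * length U        ≤⟨ *-monoʳ-≤ (m ^ w) (s≤s (length-concatMap-≤ part* (allFin R)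
                                   (λ i → ≤-trans (length-filter nonzero? (part i)) (≤-reflexive (length-part i))))) ⟩
      m ^ w * suc (length (allFin R) * size) ≡⟨ cong (λ n → m ^ w * suc (n * size)) (length-tabulate {n = R} (λ i → i)) ⟩
      m ^ w * suc (R * size)  ∎
      where open ≤-Reasoning

    ++∈spread-basis : ∀ {x : El w} {u} → u ∈ U → x ++ u ∈ spread-basis
    ++∈spread-basis {x} u∈ = ∈-cartesianProductWith⁺ _++_ (∈-elements x) u∈

    -- Sums and differences are counted together: a ⊕ b = a ⊖ τ b and a ⊖ b = a ⊖ τ b
    -- for the automorphisms τ = negᵛ and τ = id, both of which preserve every part.
    module Representations
      (_op_         : ∀ {k} → El k → El k → El k)
      (op-++        : ∀ {a b} (x : El a) (y : El b) x′ y′ → (x ++ y) op (x′ ++ y′) ≡ (x op x′) ++ (y op y′))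
      (τ            : ∀ {k} → El k → El k)
      (op-τ         : ∀ {k} (a b : El k) → a op τ b ≡ a ⊖ b)
      (τ-involutive : ∀ {k} (a : El k) → τ (τ a) ≡ a)
      (τ-0ᵛ         : ∀ {k} → τ (0ᵛ {k}) ≡ 0ᵛ)
      (τ-part       : ∀ {i a} → a ∈ part i → τ a ∈ part i) where

      private
        op-0ᵛ : ∀ {k} (x : El k) → x op 0ᵛ ≡ x
        op-0ᵛ x = trans (cong (x op_) (sym τ-0ᵛ)) (trans (op-τ x 0ᵛ) (Vᴸ.x-ε≡x x))

        op-solve : ∀ {k} (z y : El k) → (z ⊕ τ y) op y ≡ z
        op-solve z y = trans (cong ((z ⊕ τ y) op_) (sym (τ-involutive y)))
                             (trans (op-τ (z ⊕ τ y) (τ y)) (Vᴸ.//-rightDividesʳ (τ y) z))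

        Pair = El (w + d) × El (w + d)

        Represents : El (w + d) → Pair → Set
        Represents z (a , b) = a ∈ spread-basis × b ∈ spread-basis × a op b ≡ z

        length≤reps : ∀ z {pairs : List Pair} → Unique pairs → (∀ {p} → p ∈ pairs → Represents z p) →
          length pairs ≤ reps _op_ spread-basis z
        length≤reps z u represents = length-mono-⊆ (Product.≡-dec _≟_ _≟_) u λ p∈ →
          let a∈ , b∈ , a-b≡z = represents p∈
          in ∈-filter⁺ (λ p → (proj₁ p op proj₂ p) ≟ z) (∈-cartesianProduct⁺ a∈ b∈) a-b≡z

      reps-zero : ∀ (zw : El w) → size ≤ reps _op_ spread-basis (zw ++ 0ᵛ)
      reps-zero zw = ≤-trans (≤-reflexive (sym (trans (length-map F (part fzero)) (length-part fzero))))
                             (length≤reps (zw ++ 0ᵛ) (map⁺ F-injective (part-unique fzero)) F-represents)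
        where
        F : El d → Pair
        F a = zw ++ a , 0ᵛ ++ τ a

        F-injective : ∀ {a a′} → F a ≡ F a′ → a ≡ a′
        F-injective eq = ++-injectiveʳ zw zw (cong proj₁ eq)

        F-represents : ∀ {p} → p ∈ map F (part fzero) → Represents (zw ++ 0ᵛ) p
        F-represents p∈ with a , a∈ , refl ← ∈-map⁻ F p∈ =
          ++∈spread-basis (part⊆U a∈) , ++∈spread-basis (part⊆U (τ-part a∈)) ,
          trans (op-++ zw a 0ᵛ (τ a)) (cong₂ _++_ (op-0ᵛ zw) (trans (op-τ a a) (Vᴸ.inverseʳ a)))

      private module Nonzero (zw : El w) {zu : El d} (zu≢0 : zu ≢ 0ᵛ) where

        avoids? : (i : Fin R) → Dec (zu ∉ part i)
        avoids? i = ¬? (zu ∈? part i)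

        avoiding : List (Fin R)
        avoiding = filter avoids? (allFin R)

        avoiding-unique : Unique avoiding
        avoiding-unique = filter⁺ avoids? (allFin⁺ R)

        R′≤length-avoiding : R′ ≤ length avoiding
        R′≤length-avoiding = ≤-pred (subst (_≤ suc (length avoiding)) (length-tabulate {n = R} (λ i → i))
          (length≤suc-filter _≟ᶠ_ avoids? (allFin⁺ R) λ {i} {j} _ _ zu∈i zu∈j →
            decidable-stable (i ≟ᶠ j) λ i≢j →
              zu≢0 (parts-meet-in-0ᵛ i≢j (decidable-stable (zu ∈? part i) zu∈i) (decidable-stable (zu ∈? part j) zu∈j))))

        -- The value for i ≡ j is junk and never used.
        pair : Fin R → Fin R → El d × El d
        pair i j with i ≟ᶠ j
        ... | yes _   = 0ᵛ , 0ᵛ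
        ... | no  i≢j = let a , b , _ = parts-cover S i≢j zu in a , b

        pair-spec : ∀ {i j} → i ≢ j → let a , b = pair i j in a ∈ part i × b ∈ part j × a ⊖ b ≡ zu
        pair-spec {i} {j} i≢j with i ≟ᶠ j
        ... | yes i≡j = ⊥-elim (i≢j i≡j)
        ... | no  i≢j = let _ , _ , spec = parts-cover S i≢j zu in spec

        module _ {i j} (i∈ : i ∈ avoiding) (j∈ : j ∈ avoiding) (i≢j : i ≢ j) where
          a b : El d
          a = proj₁ (pair i j)
          b = proj₂ (pair i j)

          a∈ : a ∈ part i
          a∈ = proj₁ (pair-spec i≢j)

          b∈ : b ∈ part j
          b∈ = proj₁ (proj₂ (pair-spec i≢j))

          a-b≡zu : a ⊖ b ≡ zu
          a-b≡zu = proj₂ (proj₂ (pair-spec i≢j))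

          a≢0 : a ≢ 0ᵛ
          a≢0 a≡0 = proj₂ (∈-filter⁻ avoids? j∈)
            (subst (_∈ part j) (trans (sym (Vᴸ.identityˡ (negᵛ b))) (trans (cong (_⊖ b) (sym a≡0)) a-b≡zu)) (negᵛ∈part S j b∈))

          τb≢0 : τ b ≢ 0ᵛ
          τb≢0 τb≡0 = proj₂ (∈-filter⁻ avoids? i∈)
            (subst (_∈ part i) (trans (sym (Vᴸ.x-ε≡x a)) (trans (cong (a ⊖_) (sym b≡0)) a-b≡zu)) a∈)
            where b≡0 = trans (sym (τ-involutive b)) (trans (cong τ τb≡0) τ-0ᵛ)

        triples : List ((Fin R × Fin R) × El w)
        triples = cartesianProduct (offDiagonal _≟ᶠ_ avoiding) (elements w)

        F : (Fin R × Fin R) × El w → Pair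
        F ((i , j) , y) = (zw ⊕ τ y) ++ proj₁ (pair i j) , y ++ τ (proj₂ (pair i j))

        ∈-triples⁻ : ∀ {i j y} → ((i , j) , y) ∈ triples → i ∈ avoiding × j ∈ avoiding × i ≢ j
        ∈-triples⁻ t∈ = ∈-offDiagonal⁻ _≟ᶠ_ (proj₁ (∈-cartesianProduct⁻ _ _ t∈))

        F-injective : ∀ {t t′} → t ∈ triples → t′ ∈ triples → F t ≡ F t′ → t ≡ t′
        F-injective {(i , j) , y} {(i′ , j′) , y′} t∈ t′∈ Ft≡Ft′
          with i∈ , j∈ , i≢j ← ∈-triples⁻ t∈ | i′∈ , j′∈ , i′≢j′ ← ∈-triples⁻ t′∈ =
          let a≡a′   = ++-injectiveʳ (zw ⊕ τ y) (zw ⊕ τ y′) (cong proj₁ Ft≡Ft′)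
              τb≡τb′ = ++-injectiveʳ y y′ (cong proj₂ Ft≡Ft′)
              i≡i′ = decidable-stable (i ≟ᶠ i′) λ i≢i′ → a≢0 i∈ j∈ i≢j
                (parts-meet-in-0ᵛ i≢i′ (a∈ i∈ j∈ i≢j) (subst (_∈ part i′) (sym a≡a′) (a∈ i′∈ j′∈ i′≢j′)))
              j≡j′ = decidable-stable (j ≟ᶠ j′) λ j≢j′ → τb≢0 i∈ j∈ i≢j
                (parts-meet-in-0ᵛ j≢j′ (τ-part (b∈ i∈ j∈ i≢j))
                  (subst (_∈ part j′) (sym τb≡τb′) (τ-part (b∈ i′∈ j′∈ i′≢j′))))
          in cong₂ _,_ (cong₂ _,_ i≡i′ j≡j′) (++-injectiveˡ y y′ (cong proj₂ Ft≡Ft′))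

        F-represents : ∀ {p} → p ∈ map F triples → Represents (zw ++ zu) p
        F-represents p∈ with ∈-map⁻ F p∈
        ... | ((i , j) , y) , t∈ , refl with i∈ , j∈ , i≢j ← ∈-triples⁻ t∈ =
          ++∈spread-basis (part⊆U (a∈ i∈ j∈ i≢j)) , ++∈spread-basis (part⊆U (τ-part (b∈ i∈ j∈ i≢j))) ,
          trans (op-++ (zw ⊕ τ y) _ y _) (cong₂ _++_ (op-solve zw y) (trans (op-τ _ _) (a-b≡zu i∈ j∈ i≢j)))

      reps-nonzero : ∀ (zw : El w) {zu} → zu ≢ 0ᵛ → m ^ w * (R′ * (R′ ∸ 1)) ≤ reps _op_ spread-basis (zw ++ zu)
      reps-nonzero zw {zu} zu≢0 = begin
        m ^ w * (R′ * (R′ ∸ 1))                       ≤⟨ *-monoʳ-≤ (m ^ w) (*-mono-≤ R′≤length-avoiding (∸-monoˡ-≤ 1 R′≤length-avoiding)) ⟩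
        m ^ w * (length avoiding * (length avoiding ∸ 1)) ≤⟨ *-monoʳ-≤ (m ^ w) (length-offDiagonal _≟ᶠ_ avoiding-unique) ⟩
        m ^ w * length pairs                          ≡⟨ *-comm (m ^ w) (length pairs) ⟩
        length pairs * m ^ w                          ≡⟨ cong (length pairs *_) (length-elements w) ⟨
        length pairs * length (elements w)            ≡⟨ length-cartesianProductWith _,_ pairs (elements w) ⟨
        length triples                                ≡⟨ length-map F triples ⟨
        length (map F triples)                        ≤⟨ length≤reps (zw ++ zu) F-triples-unique F-represents ⟩
        reps _op_ spread-basis (zw ++ zu)                    ∎
        where
        open ≤-Reasoning
        open Nonzero zw zu≢0
        pairs = offDiagonal _≟ᶠ_ avoiding

        F-triples-unique : Unique (map F triples)
        F-triples-unique = unique-map-injectiveOn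
          (cartesianProduct⁺ (offDiagonal-unique _≟ᶠ_ avoiding-unique) (elements-unique w)) F-injective

      g-basis : ∀ {g} → g ≤ size → g ≤ m ^ w * (R′ * (R′ ∸ 1)) → ∀ z → g ≤ reps _op_ spread-basis z
      g-basis g≤size g≤mʷR′[R′-1] z with splitAt w z
      ... | zw , zu , refl with zu ≟ 0ᵛ
      ...   | yes refl = ≤-trans g≤size (reps-zero zw)
      ...   | no zu≢0  = ≤-trans g≤mʷR′[R′-1] (reps-nonzero zw zu≢0)

    spread-basis-is-g-basis : ∀ {g} → g ≤ size → g ≤ m ^ w * (R′ * (R′ ∸ 1)) →
      IsDiffBasis g (w + d) spread-basis × IsAddBasis g (w + d) spread-basis
    spread-basis-is-g-basis g≤size g≤mʷR′[R′-1] = Differences.g-basis g≤size g≤mʷR′[R′-1] , Sums.g-basis g≤size g≤mʷR′[R′-1]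
      where
      module Differences = Representations _⊖_ ⊖-++ id (λ _ _ → refl) (λ _ → refl) refl id
      module Sums        = Representations _⊕_ ⊕-++ negᵛ (λ _ _ → refl) Vᴸ.⁻¹-involutive Vᴸ.ε⁻¹≈ε (negᵛ∈part S _)

  module Asymptotics (1<m : 1 < m) where

    instance
      m≢0 : NonZero m
      m≢0 = >-nonZero (<-trans (s≤s z≤n) 1<m)

    D : ℕ
    D = 576 * m ^ 6

    record NearlyOptimalBasis (g n : ℕ) : Set where
      field
        basis          : List (El n)
        unique         : Unique basis
        isDiffBasis    : IsDiffBasis g n basis
        isAddBasis     : IsAddBasis g n basis
        nearly-optimal : let s² = length basis * length basis; M = g * m ^ n in
                         g * ((s² ∸ M) * (s² ∸ M)) ≤ D * (M * M)

    g²≤d⇒g≤size : ∀ {g R d} (S : Spread R d) → g * g ≤ d → g ≤ Spread.size S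
    g²≤d⇒g≤size {g} {d = d} S g²≤d with g ≤? Spread.size S
    ... | yes g≤size = g≤size
    ... | no  g≰size = contradiction (begin-strict
          size * size  <⟨ *-mono-< (≰⇒> g≰size) (≰⇒> g≰size) ⟩
          g * g        ≤⟨ g²≤d ⟩
          d            <⟨ n<m^n 1<m d ⟩
          m ^ d        ≡⟨ Spread.size²≡mᵈ S ⟨
          size * size  ∎) (<-irrefl refl)
      where
      open ≤-Reasoning
      size = Spread.size S

    -- P = 2 (g + m)! annihilates G and is divisible by every d ≤ g; the base spreads take k = P and k = P - 2.
    module _ {g : ℕ} (1≤g : 1 ≤ g) where

      private
        p p′ P : ℕ
        p  = (g + m) !
        p′ = p ∸ 1
        P  = p + p

        instance
          p≢0 : NonZero p
          p≢0 = (g + m) !≢0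

        1+p′≡p : suc p′ ≡ p
        1+p′≡p = suc-pred p

        1≤p′ : 1 ≤ p′
        1≤p′ = ∸-monoˡ-≤ 1 (≤-trans 1<m (≤-trans (m≤n+m m g) (n≤n! (g + m))))
          where
          n≤n! : ∀ n → n ≤ n !
          n≤n! zero    = z≤n
          n≤n! (suc n) = ≤-trans (≤-reflexive (sym (*-identityʳ (suc n)))) (*-monoʳ-≤ (suc n) (1≤n! n))

      P-annihilates : ∀ c → P · c ≡ ε
      P-annihilates c = let d , 1≤d , d≤m , d·c≡ε = order-bounded c in
        ·-∣ d·c≡ε (∣-trans (∣-! (g + m) 1≤d (≤-trans d≤m (m≤n+m m g))) (∣m∣n⇒∣m+n ∣-refl ∣-refl))

      divisors-of-P : ∀ {R′} → R′ ≤ suc g → ∀ d → 1 ≤ d → d < R′ → d ∣ P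
      divisors-of-P R′≤1+g d 1≤d d<R′ =
        ∣-trans (∣-! (g + m) 1≤d (≤-trans (≤-pred (≤-trans d<R′ R′≤1+g)) (m≤m+n g m))) (∣m∣n⇒∣m+n ∣-refl ∣-refl)

      spread : ∀ {R′} → R′ ≤ suc g → ∀ a b → Spread (suc R′) (a * (P + P) + b * ((p′ + p′) + (p′ + p′)))
      spread R′≤1+g a b = (base-spread P-annihilates (inj₁ refl) (divisors-of-P R′≤1+g) ⊗^ a)
                        ⊗ (base-spread P-annihilates (inj₂ 2+2p′≡P) (divisors-of-P R′≤1+g) ⊗^ b)
        where
        2+2p′≡P : suc (suc (p′ + p′)) ≡ P
        2+2p′≡P = trans (cong suc (sym (+-suc p′ p′))) (cong₂ _+_ 1+p′≡p 1+p′≡p)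

      threshold : ℕ
      threshold = (p′ * p′ + g * g) * 4

      g²≤threshold : g * g ≤ threshold
      g²≤threshold = ≤-trans (m≤n+m (g * g) (p′ * p′)) (m≤m*n _ 4)

      -- n = w + 4k with w < 4 and k = a p + b p′ (as k ≥ p′²), matching the base dimensions 2P = 4p and 2(P - 2) = 4p′.
      split-dimension : ∀ n → threshold ≤ n → ∃ λ w → ∃₂ λ a b →
        let d = a * (P + P) + b * ((p′ + p′) + (p′ + p′)) in w ≤ 3 × w + d ≡ n × g * g ≤ d
      split-dimension n threshold≤n =
        let a , b , a[1+p′]+bp′≡k = frobenius p′ {{>-nonZero 1≤p′}} k (≤-trans (m≤m+n (p′ * p′) (g * g)) bound≤k)
            d≡4k = trans (dimension a b) (cong (_* 4) a[1+p′]+bp′≡k)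
        in n % 4 , a , b , ≤-pred (m%n<n n 4) , trans (cong (n % 4 +_) d≡4k) (sym (m≡m%n+[m/n]*n n 4)) ,
           ≤-trans (m≤n+m (g * g) (p′ * p′)) (≤-trans bound≤k (≤-trans (m≤m*n k 4) (≤-reflexive (sym d≡4k))))
        where
        k = n / 4
        bound≤k : p′ * p′ + g * g ≤ k
        bound≤k = ≤-trans (≤-reflexive (sym (m*n/n≡m (p′ * p′ + g * g) 4))) (/-monoˡ-≤ 4 threshold≤n)
        dimension : ∀ a b → a * (P + P) + b * ((p′ + p′) + (p′ + p′)) ≡ (a * suc p′ + b * p′) * 4
        dimension a b = trans (cong (λ q → a * ((q + q) + (q + q)) + b * ((p′ + p′) + (p′ + p′))) (sym 1+p′≡p))
          (solve 3 (λ a b p′ → a :* (((con 1 :+ p′) :+ (con 1 :+ p′)) :+ ((con 1 :+ p′) :+ (con 1 :+ p′)))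
                                 :+ b :* ((p′ :+ p′) :+ (p′ :+ p′))
                               := (a :* (con 1 :+ p′) :+ b :* p′) :* con 4) refl a b p′)
          where open +-*-Solver

      nearly-optimal-basis : ∀ n → threshold ≤ n → NearlyOptimalBasis g n
      nearly-optimal-basis n threshold≤n with split-dimension n threshold≤n
      ... | w , a , b , w≤3 , refl , g²≤d with sqrt-bracket 1≤g (m^n>0 m w)
      ...   | t , Wt²<g , g≤W[1+t]² = record
        { basis          = spread-basis S w
        ; unique         = spread-basis-unique S w
        ; isDiffBasis    = proj₁ is-g-basis
        ; isAddBasis     = proj₂ is-g-basis
        ; nearly-optimal = subst (λ T → g * ((s * s ∸ g * T) * (s * s ∸ g * T)) ≤ D * ((g * T) * (g * T)))
                                 (trans (cong (W *_) (Spread.size²≡mᵈ S)) (sym (^-distribˡ-+-* m w _)))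
                                 (size-estimate {t = t} Wt²<g s≤W[1+[t+3]h] 1≤h (m^n>0 m w) W²≤m⁶)
        }
        where
        W = m ^ w

        t<g : t < g
        t<g = ≤-<-trans (≤-trans (n≤n*n t) (m≤n*m (t * t) W {{m^n≢0 m w}})) Wt²<g
          where
          n≤n*n : ∀ n → n ≤ n * n
          n≤n*n zero    = z≤n
          n≤n*n (suc n) = m≤m*n (suc n) (suc n)

        S = spread {R′ = suc (suc t)} (s≤s t<g) a b
        h = Spread.size S
        s = length (spread-basis S w)

        g≤h : g ≤ h
        g≤h = g²≤d⇒g≤size S g²≤d

        1≤h : 1 ≤ h
        1≤h = ≤-trans 1≤g g≤h

        is-g-basis = spread-basis-is-g-basis S w g≤h
          (≤-trans g≤W[1+t]² (*-monoʳ-≤ W (*-monoˡ-≤ (suc t) (n≤1+n (suc t)))))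

        s≤W[1+[t+3]h] : s ≤ W * suc ((t + 3) * h)
        s≤W[1+[t+3]h] = ≤-trans (length-spread-basis S w) (≤-reflexive (cong (λ r → W * suc (r * h)) (+-comm 3 t)))

        W²≤m⁶ : W * W ≤ m ^ 6
        W²≤m⁶ = ≤-trans (≤-reflexive (sym (^-distribˡ-+-* m w w))) (^-monoʳ-≤ m (+-mono-≤ w≤3 w≤3))

    limsup-bounds : ∀ {g} → 1 ≤ g → (e : ℕ → ℕ) → (∀ n → g ≤ m ^ n → g * m ^ n ≤ e n * e n) →
      (∀ n → g ≤ m ^ n → ∀ A → Unique A → IsDiffBasis g n A → IsAddBasis g n A → e n ≤ length A) →
      LimsupUpper (ℕtoℚ D) g m e × LimsupLower (ℕtoℚ D) g m e
    limsup-bounds {g} 1≤g e g·mⁿ≤eₙ² eₙ≤ = upper , lower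
      where
      g≤mⁿ : ∀ {n} → g * g ≤ n → g ≤ m ^ n
      g≤mⁿ {n} g²≤n = ≤-trans (m≤m*n g g {{>-nonZero 1≤g}}) (≤-trans g²≤n (<⇒≤ (n<m^n 1<m n)))

      upper : LimsupUpper (ℕtoℚ D) g m e
      upper δ δ>0 = threshold 1≤g , λ n threshold≤n →
        let open NearlyOptimalBasis (nearly-optimal-basis 1≤g n threshold≤n)
            eₙ≤|basis| = eₙ≤ n (g≤mⁿ (≤-trans (g²≤threshold 1≤g) threshold≤n))
                            basis unique isDiffBasis isAddBasis
        in upper-condition (e n * e n) (length basis * length basis) (g * m ^ n) g D δ δ>0
             (*-mono-≤ eₙ≤|basis| eₙ≤|basis|) nearly-optimal

      lower : LimsupLower (ℕtoℚ D) g m e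
      lower δ δ>0 N = N + g * g , m≤m+n N (g * g) ,
        inj₁ (lower-condition (e (N + g * g) * e (N + g * g)) (g * m ^ (N + g * g)) δ δ>0
               (g·mⁿ≤eₙ² (N + g * g) (g≤mⁿ (m≤n+m (g * g) N))))

    η-lower-bound : ∀ {g n k} → IsEta g n k → g * m ^ n ≤ k * k
    η-lower-bound ((A , _ , refl , isDiffBasis) , _) = g-basis⇒g·mⁿ≤size² _⊖_ A isDiffBasis

    ν-lower-bound : ∀ {g n k} → IsNu g n k → g * m ^ n ≤ k * k
    ν-lower-bound ((A , _ , refl , isAddBasis) , _) = g-basis⇒g·mⁿ≤size² _⊕_ A isAddBasis

theorem1p5 : ∀ (m : ℕ) (_∙_ : Fin m → Fin m → Fin m) (ε : Fin m) (_⁻¹ : Fin m → Fin m)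
    → IsAbelianGroup _≡_ _∙_ ε _⁻¹
    → 1 < m
    → Σ ℚ λ D → ∀ (g : ℕ) → 1 ≤ g
      → (∀ (e : ℕ → ℕ) → (∀ n → g ≤ m ^ n → FinGroup.IsEta m _∙_ _⁻¹ g n (e n))
          → LimsupUpper D g m e × LimsupLower D g m e)
      × (∀ (e : ℕ → ℕ) → (∀ n → g ≤ m ^ n → FinGroup.IsNu m _∙_ _⁻¹ g n (e n))
          → LimsupUpper D g m e × LimsupLower D g m e)
theorem1p5 m _∙_ ε _⁻¹ isAbelianGroup 1<m = ℕtoℚ D , λ g 1≤g →
    (λ e e≡η → limsup-bounds 1≤g e (λ n g≤mⁿ → η-lower-bound (e≡η n g≤mⁿ))
                                   (λ n g≤mⁿ A A-unique isDiffBasis _ → proj₂ (e≡η n g≤mⁿ) A A-unique isDiffBasis))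
  , (λ e e≡ν → limsup-bounds 1≤g e (λ n g≤mⁿ → ν-lower-bound (e≡ν n g≤mⁿ))
                                   (λ n g≤mⁿ A A-unique _ isAddBasis → proj₂ (e≡ν n g≤mⁿ) A A-unique isAddBasis))
  where
  open FiniteAbelianGroup m _∙_ ε _⁻¹ isAbelianGroup
  open Asymptotics 1<m
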